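{- Let $p>3$ be a prime. (1) If $m$ is an integer with $p\nmid m$ and $$F_3(x)=\frac{x^{3p-9}-1}{x-1}-x^{3p-6}(1+x^3+x^6)\,\frac{x^{p-3-3m}-1}{x-1}$$ (multiplied by a suitable power of $x$ to make it a polynomial if $3m>p-3$), then $M_{3p}(F_3)=3^4m$. (2) If $m$ is a positive integer with $\gcd(m,3p)=1$ and $F_4(x)=(1+x^3+x^6)\prod_{q^{\alpha}\parallel m}\Phi_q(x)^{\alpha}$ (product over the prime powers $q^\alpha$ exactly dividing $m$), then $M_{3p}(F_4)=3^3m$.
   Context: For a polynomial $F\in\mathbb Z[x]$, $M_n(F)=\prod_{j=1}^n F(\omega_n^j)$ with $\omega_n=e^{2\pi i/n}$; $\Phi_q$ is the $q$-th cyclotomic polynomial. For an integer $N$, $\frac{x^N-1}{x-1}$ denotes $1+x+\dots+x^{N-1}$ if $N\ge 0$ and $-x^{N}(1+x+\dots+x^{ -N-1})$ if $N<0$. -}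

module Defs where

open import Level using (Level; _⊔_)
open import Data.Nat as ℕ using (ℕ; zero; suc; _∸_; _<_; _≤_)
open import Data.Nat.Primality using (Prime)
open import Data.Integer as ℤ using (ℤ; +_; -[1+_])
open import Data.List using (List; []; _∷_; map; replicate; _++_; foldr; [_])
open import Data.List.Relation.Unary.All using (All)
open import Data.List.Relation.Unary.Unique.Propositional using (Unique)
open import Data.Product using (_×_; _,_; proj₁)
open import Data.Sum using (_⊎_)
open import Relation.Binary.PropositionalEquality using (_≡_)
open import Relation.Nullary using (¬_)
open import Algebra.Bundles using (CommutativeRing; Semiring)
import Algebra.Definitions.RawSemiring as RS

-- Integer polynomials as coefficient lists (constant term first).

Poly : Set
Poly = List ℤ

infixl 6 _+ₚ_ _-ₚ_
infixl 7 _*ₚ_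

_+ₚ_ : Poly → Poly → Poly
[] +ₚ q = q
(a ∷ p) +ₚ [] = a ∷ p
(a ∷ p) +ₚ (b ∷ q) = (a ℤ.+ b) ∷ (p +ₚ q)

scaleₚ : ℤ → Poly → Poly
scaleₚ a = map (a ℤ.*_)

negₚ : Poly → Poly
negₚ = map (λ a → ℤ.- a)

_-ₚ_ : Poly → Poly → Poly
p -ₚ q = p +ₚ negₚ q

_*ₚ_ : Poly → Poly → Poly
[] *ₚ q = []
(a ∷ p) *ₚ q = scaleₚ a q +ₚ ((+ 0) ∷ (p *ₚ q))

oneₚ : Poly
oneₚ = [ + 1 ]

_^ₚ_ : Poly → ℕ → Poly
p ^ₚ zero = oneₚ
p ^ₚ suc n = p *ₚ (p ^ₚ n)

X^ : ℕ → Poly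
X^ k = replicate k (+ 0) ++ [ + 1 ]

-- (x^N - 1)/(x - 1) = 1 + x + ... + x^(N-1) for N ≥ 0
geom : ℕ → Poly
geom n = replicate n (+ 1)

Φprime : ℕ → Poly
Φprime q = geom q

T₃ : Poly
T₃ = X^ 0 +ₚ X^ 3 +ₚ X^ 6

-- With N = p-3-3m:
--  * N ≥ 0 : F₃ = (x^(3p-9)-1)/(x-1) - x^(3p-6)(1+x^3+x^6)(x^N-1)/(x-1)
--  * N = -k < 0 : (x^N-1)/(x-1) = -x^(-k)(1+...+x^(k-1)), and F₃ is
--    multiplied by x^k to become the polynomial
--    x^k (x^(3p-9)-1)/(x-1) + x^(3p-6)(1+x^3+x^6)(1+...+x^(k-1)).

F₃ : ℕ → ℤ → Poly
F₃ p m with (+ (p ∸ 3)) ℤ.- ((+ 3) ℤ.* m)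
... | + n      = geom (3 ℕ.* p ∸ 9) -ₚ X^ (3 ℕ.* p ∸ 6) *ₚ T₃ *ₚ geom n
... | -[1+ j ] = X^ (suc j) *ₚ geom (3 ℕ.* p ∸ 9)
                   +ₚ X^ (3 ℕ.* p ∸ 6) *ₚ T₃ *ₚ geom (suc j)

-- F₄ of part (2), given the prime factorisation of m as a list of
-- pairs (q , α) meaning q^α ∥ m.

F₄ : List (ℕ × ℕ) → Poly
F₄ fs = T₃ *ₚ foldr (λ { (q , α) r → (Φprime q ^ₚ α) *ₚ r }) oneₚ fs

IsFactorisation : ℕ → List (ℕ × ℕ) → Set
IsFactorisation m fs =
  All (λ { (q , α) → Prime q × 1 ≤ α }) fs
  × Unique (map proj₁ fs)
  × m ≡ foldr (λ { (q , α) r → (q ℕ.^ α) ℕ.* r }) 1 fs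

module _ {c ℓ : Level} (R : CommutativeRing c ℓ) where
  open CommutativeRing R
  open RS (Semiring.rawSemiring semiring) using (_^_) renaming (_×_ to _·1_)

  ι : ℤ → Carrier
  ι (+ n) = n ·1 1#
  ι -[1+ n ] = - (suc n ·1 1#)

  eval : Poly → Carrier → Carrier
  eval [] y = 0#
  eval (a ∷ p) y = ι a + y * eval p y

  M : ℕ → Carrier → Poly → Carrier
  M n ω F = go n
    where
    go : ℕ → Carrier
    go zero = 1#
    go (suc j) = eval F (ω ^ suc j) * go j

  record CharZeroDomain : Set (c ⊔ ℓ) where
    field
      nontrivial : ¬ (1# ≈ 0#)
      noZeroDivisors : ∀ x y → x * y ≈ 0# → (x ≈ 0#) ⊎ (y ≈ 0#)
      charZero : ∀ n → ¬ (suc n ·1 1# ≈ 0#)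

  record PrimitiveRoot (n : ℕ) (ω : Carrier) : Set ℓ where
    field
      root : ω ^ n ≈ 1#
      isPrimitive : ∀ k → 0 < k → k < n → ¬ (ω ^ k ≈ 1#)

{-# OPTIONS --safe #-}
-- Write y = ω^j, 1 ≤ j ≤ 3p. Away from the multiples of p the factors are removed by a
-- ratio argument: if F(y)·v(y) is a product of functions of y^k with k prime to 3p, then,
-- as j ↦ kj permutes the residues and v does not vanish there, the product of the F(y) is 1.
-- The identities used are (1 + y³ + y⁶)(y³ - 1) = y^(3(p+3)) - 1, Φ_q(y)(y - 1) = y^q - 1
-- and F₃(y)(y - 1)(1 - y³) = (y^(3p-9) - 1)·y^e·(1 - y^c) with c ≡ p - 3m (mod 3p).
-- At the multiples of p, 1 + y³ + y⁶ = 3, Φ_q(1) = q and F₃(1) = 9m, while at the primitive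
-- cube roots of unity F₃(z)(z - 1) = ±3(z^N - 1) with 3 ∤ N, whence F₃(z)F₃(z²) = 9.
module Submission where

open import Defs
open import Level using (Level)
open import Data.Nat as ℕ using (ℕ; zero; suc)
import Data.Nat.Properties as ℕP
open import Data.Integer as ℤ using (ℤ; +_; -[1+_]; _⊖_)
import Data.Integer.Properties as ℤP
import Data.Integer.Tactic.RingSolver as ℤSolver
import Data.Integer.Divisibility as ℤ∣
import Data.Integer.Divisibility.Signed as Signed
import Data.Sign as Sign
open import Data.Sum using (inj₁; inj₂; [_,_]′)
open import Data.List using ([]; _∷_; foldr)
open import Data.Maybe using (Maybe; just; nothing)
open import Relation.Binary.PropositionalEquality as ≡ using (_≡_; _≢_)
open import Algebra.Bundles using (CommutativeRing; Semiring)
import Algebra.Definitions.RawSemiring as RawSemiringDefinitions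
import Algebra.Solver.Ring.AlmostCommutativeRing as ACR
import Algebra.Solver.Ring as RingSolver
open import Data.Nat.Tactic.RingSolver using (solve-∀)
open import Data.Nat.Primality using (Prime)
open import Data.Nat.Coprimality as Coprimality using (Coprime)
open import Data.Product using (∃; _,_; _×_)
open import Data.Empty using (⊥-elim)
open import Relation.Nullary using (¬_; yes; no)

module Arithmetic where
  open import Data.Nat.DivMod
  open import Data.Nat.Divisibility
  open import Data.Nat.Coprimality using (coprime-Bézout; coprime-divisor)
  open import Data.Nat.GCD using (module Bézout)
  open import Data.Nat.Primality using (prime?; prime⇒irreducible)
  open import Relation.Nullary.Decidable using (from-yes)
  open import Data.Fin using (Fin; toℕ; fromℕ<)
  import Data.Fin.Properties as FinP
  open import Data.Fin.Permutation using (Permutation; permutation)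

  coprime⇒∃-inverse-mod : ∀ {n k} .{{_ : ℕ.NonZero n}} → 2 ℕ.≤ n → Coprime k n → ∃ λ k′ → (k′ ℕ.* k) % n ≡ 1
  coprime⇒∃-inverse-mod {suc zero} (ℕ.s≤s ()) _
  coprime⇒∃-inverse-mod {suc (suc t)} {k} _ k⊥n with coprime-Bézout k⊥n
  ... | Bézout.+- x y eq = x , (begin
    (x ℕ.* k) % n          ≡⟨ ≡.cong (_% n) (≡.sym eq) ⟩
    (1 ℕ.+ y ℕ.* n) % n    ≡⟨ %-remove-+ʳ 1 (n∣m*n y) ⟩
    1                      ∎)
    where
    n = suc (suc t)
    open ≡.≡-Reasoning
  ... | Bézout.-+ x zero ()
  ... | Bézout.-+ x (suc y) eq = x ℕ.* suc t , (begin
    (x ℕ.* suc t ℕ.* k) % n                       ≡⟨ ≡.cong (_% n) (reorder x (suc t) k) ⟩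
    ((x ℕ.* k) ℕ.* suc t) % n                     ≡⟨ ≡.cong (λ u → (u ℕ.* suc t) % n) (ℕP.suc-injective eq) ⟩
    ((suc t ℕ.+ y ℕ.* n) ℕ.* suc t) % n           ≡⟨ ≡.cong (_% n) (expand t y) ⟩
    (1 ℕ.+ (t ℕ.+ y ℕ.* suc t) ℕ.* n) % n         ≡⟨ %-remove-+ʳ 1 (n∣m*n (t ℕ.+ y ℕ.* suc t)) ⟩
    1                                             ∎)
    where
    n = suc (suc t)
    open ≡.≡-Reasoning
    reorder : ∀ a b c → a ℕ.* b ℕ.* c ≡ (a ℕ.* c) ℕ.* b
    reorder = solve-∀
    -- (n - 1)² ≡ 1 (mod n)
    expand : ∀ t y → (suc t ℕ.+ y ℕ.* suc (suc t)) ℕ.* suc t ≡ 1 ℕ.+ (t ℕ.+ y ℕ.* suc t) ℕ.* suc (suc t)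
    expand = solve-∀

  %-*-% : ∀ a b n .{{_ : ℕ.NonZero n}} → (a ℕ.* (b % n)) % n ≡ (a ℕ.* b) % n
  %-*-% a b n = ≡.trans (%-distribˡ-* a (b % n) n)
    (≡.trans (≡.cong (λ t → ((a % n) ℕ.* t) % n) (m%n%n≡m%n b n)) (≡.sym (%-distribˡ-* a b n)))

  inverse-cancels : ∀ {n} .{{_ : ℕ.NonZero n}} k k′ → (k′ ℕ.* k) % n ≡ 1 → ∀ i → i ℕ.< n → (k′ ℕ.* ((k ℕ.* i) % n)) % n ≡ i
  inverse-cancels {n} k k′ k′k≡1 i i<n = begin
    (k′ ℕ.* ((k ℕ.* i) % n)) % n     ≡⟨ %-*-% k′ (k ℕ.* i) n ⟩
    (k′ ℕ.* (k ℕ.* i)) % n           ≡⟨ ≡.cong (_% n) (≡.sym (ℕP.*-assoc k′ k i)) ⟩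
    (k′ ℕ.* k ℕ.* i) % n             ≡⟨ %-distribˡ-* (k′ ℕ.* k) i n ⟩
    ((k′ ℕ.* k) % n ℕ.* (i % n)) % n ≡⟨ ≡.cong (λ t → (t ℕ.* (i % n)) % n) k′k≡1 ⟩
    (1 ℕ.* (i % n)) % n              ≡⟨ ≡.cong (_% n) (ℕP.*-identityˡ (i % n)) ⟩
    i % n % n                        ≡⟨ m%n%n≡m%n i n ⟩
    i % n                            ≡⟨ m<n⇒m%n≡m i<n ⟩
    i                                ∎
    where open ≡.≡-Reasoning

  *-permutation : ∀ {n} .{{_ : ℕ.NonZero n}} k k′ → (k′ ℕ.* k) % n ≡ 1 → Permutation n n
  *-permutation {n} k k′ k′k≡1 = permutation (times k) (times k′) (inverse k′ k kk′≡1) (inverse k k′ k′k≡1)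
    where
    kk′≡1 : (k ℕ.* k′) % n ≡ 1
    kk′≡1 = ≡.trans (≡.cong (_% n) (ℕP.*-comm k k′)) k′k≡1
    times : ℕ → Fin n → Fin n
    times a i = fromℕ< (m%n<n (a ℕ.* toℕ i) n)
    inverse : ∀ a b → (b ℕ.* a) % n ≡ 1 → ∀ i → times b (times a i) ≡ i
    inverse a b ba≡1 i = FinP.toℕ-injective (≡.trans (FinP.toℕ-fromℕ< _)
      (≡.trans (≡.cong (λ t → (b ℕ.* t) % n) (FinP.toℕ-fromℕ< _)) (inverse-cancels a b ba≡1 (toℕ i) (FinP.toℕ<n i))))

  ∤⇒coprime : ∀ {q x} → Prime q → ¬ q ∣ x → Coprime x q
  ∤⇒coprime q-prime q∤x (d∣x , d∣q) with prime⇒irreducible q-prime d∣q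
  ... | inj₁ d≡1 = d≡1
  ... | inj₂ ≡.refl = ⊥-elim (q∤x d∣x)

  module _ {p : ℕ} (p-prime : Prime p) (3<p : 3 ℕ.< p) where

    3∤p : ¬ 3 ∣ p
    3∤p 3∣p with prime⇒irreducible p-prime 3∣p
    ... | inj₂ 3≡p = ℕP.<-irrefl 3≡p 3<p

    coprime-3p : ∀ {x} → ¬ 3 ∣ x → ¬ p ∣ x → Coprime x (3 ℕ.* p)
    coprime-3p {x} 3∤x p∤x (d∣x , d∣3p) = ∤⇒coprime p-prime p∤x (d∣x , coprime-divisor d⊥3 d∣3p)
      where
      d⊥3 : Coprime _ 3
      d⊥3 (e∣d , e∣3) = ∤⇒coprime (from-yes (prime? 3)) 3∤x (∣-trans e∣d d∣x , e∣3)

module F₃-Exponents {p : ℕ} (p-prime : Prime p) (3<p : 3 ℕ.< p) (m : ℤ) (p∤m : ¬ + p ℤ∣.∣ m) where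
  open import Data.Nat.Divisibility using (_∣_; ∣⇒≤; ∣m∣n⇒∣m+n; ∣n⇒∣m*n; m∣m*n; ∣-refl)
  open import Data.Nat.Primality using (euclidsLemma)
  open Arithmetic

  n : ℕ
  n = 3 ℕ.* p

  p-3m : ℤ
  p-3m = + p ℤ.- + 3 ℤ.* m

  p-3m⊥n : ∀ {b} t → + b ≡ p-3m ℤ.+ + n ℤ.* t → Coprime b n
  p-3m⊥n {b} t b≡p-3m+nt = coprime-3p p-prime 3<p 3∤b p∤b
    where
    open ≡.≡-Reasoning
    +n≡3p : + n ≡ + 3 ℤ.* + p
    +n≡3p = ℤP.pos-* 3 p
    p≡b+3[m-pt] : + p ≡ + b ℤ.+ + 3 ℤ.* (m ℤ.- + p ℤ.* t)
    p≡b+3[m-pt] = begin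
      + p                                                   ≡⟨ identity (+ p) m t ⟩
      p-3m ℤ.+ (+ 3 ℤ.* + p) ℤ.* t ℤ.+ + 3 ℤ.* (m ℤ.- + p ℤ.* t)   ≡⟨ ≡.cong (λ x → p-3m ℤ.+ x ℤ.* t ℤ.+ + 3 ℤ.* (m ℤ.- + p ℤ.* t)) +n≡3p ⟨
      p-3m ℤ.+ + n ℤ.* t ℤ.+ + 3 ℤ.* (m ℤ.- + p ℤ.* t)          ≡⟨ ≡.cong (ℤ._+ + 3 ℤ.* (m ℤ.- + p ℤ.* t)) b≡p-3m+nt ⟨
      + b ℤ.+ + 3 ℤ.* (m ℤ.- + p ℤ.* t)                      ∎
      where
      identity : ∀ P M T → P ≡ (P ℤ.- + 3 ℤ.* M) ℤ.+ (+ 3 ℤ.* P) ℤ.* T ℤ.+ + 3 ℤ.* (M ℤ.- P ℤ.* T)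
      identity = ℤSolver.solve-∀
    3m≡p[1+3t]-b : + 3 ℤ.* m ≡ + p ℤ.* (+ 1 ℤ.+ + 3 ℤ.* t) ℤ.- + b
    3m≡p[1+3t]-b = begin
      + 3 ℤ.* m                                             ≡⟨ identity (+ p) m t ⟩
      + p ℤ.* (+ 1 ℤ.+ + 3 ℤ.* t) ℤ.- (p-3m ℤ.+ (+ 3 ℤ.* + p) ℤ.* t) ≡⟨ ≡.cong (λ x → + p ℤ.* (+ 1 ℤ.+ + 3 ℤ.* t) ℤ.- (p-3m ℤ.+ x ℤ.* t)) +n≡3p ⟨
      + p ℤ.* (+ 1 ℤ.+ + 3 ℤ.* t) ℤ.- (p-3m ℤ.+ + n ℤ.* t)      ≡⟨ ≡.cong (λ x → + p ℤ.* (+ 1 ℤ.+ + 3 ℤ.* t) ℤ.- x) b≡p-3m+nt ⟨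
      + p ℤ.* (+ 1 ℤ.+ + 3 ℤ.* t) ℤ.- + b                   ∎
      where
      identity : ∀ P M T → + 3 ℤ.* M ≡ P ℤ.* (+ 1 ℤ.+ + 3 ℤ.* T) ℤ.- ((P ℤ.- + 3 ℤ.* M) ℤ.+ (+ 3 ℤ.* P) ℤ.* T)
      identity = ℤSolver.solve-∀
    3∤b : ¬ 3 ∣ b
    3∤b 3∣b = 3∤p p-prime 3<p (Signed.∣⇒∣ᵤ (≡.subst (+ 3 Signed.∣_) (≡.sym p≡b+3[m-pt])
                (Signed.∣m∣n⇒∣m+n (Signed.∣ᵤ⇒∣ {+ 3} {+ b} 3∣b) (Signed.∣m⇒∣m*n (m ℤ.- + p ℤ.* t) Signed.∣-refl))))
    p∤b : ¬ p ∣ b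
    p∤b p∣b with euclidsLemma 3 ℤ.∣ m ∣ p-prime (≡.subst (p ∣_) (ℤP.abs-* (+ 3) m) p∣∣3m∣)
      where
      p∣∣3m∣ : p ∣ ℤ.∣ + 3 ℤ.* m ∣
      p∣∣3m∣ = Signed.∣⇒∣ᵤ (≡.subst (+ p Signed.∣_) (≡.sym 3m≡p[1+3t]-b)
                 (Signed.∣m∣n⇒∣m-n (Signed.∣m⇒∣m*n (+ 1 ℤ.+ + 3 ℤ.* t) Signed.∣-refl) (Signed.∣ᵤ⇒∣ {+ p} {+ b} p∣b)))
    ... | inj₁ p∣3 = ℕP.<⇒≱ 3<p (∣⇒≤ p∣3)
    ... | inj₂ p∣∣m∣ = p∤m p∣∣m∣

  private
    3≢1 : 3 ≢ 1
    3≢1 ()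

  -- F₃ p m branches on the sign of δ.
  δ : ℤ
  δ = + (p ℕ.∸ 3) ℤ.- + 3 ℤ.* m

  private
    open ≡.≡-Reasoning

    +[p∸3]≡p-3 : + (p ℕ.∸ 3) ≡ + p ℤ.- + 3
    +[p∸3]≡p-3 = ≡.sym (≡.trans (ℤP.[+m]-[+n]≡m⊖n p 3) (ℤP.⊖-≥ (ℕP.<⇒≤ 3<p)))

    δ≡p-3m-3 : δ ≡ p-3m ℤ.- + 3
    δ≡p-3m-3 = begin
      + (p ℕ.∸ 3) ℤ.- + 3 ℤ.* m      ≡⟨ ≡.cong (ℤ._- + 3 ℤ.* m) +[p∸3]≡p-3 ⟩
      (+ p ℤ.- + 3) ℤ.- + 3 ℤ.* m    ≡⟨ identity (+ p) m ⟩
      p-3m ℤ.- + 3                   ∎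
      where
      identity : ∀ P M → (P ℤ.- + 3) ℤ.- + 3 ℤ.* M ≡ (P ℤ.- + 3 ℤ.* M) ℤ.- + 3
      identity = ℤSolver.solve-∀

    +[3p∸9]≡3δ+9m : + (3 ℕ.* p ℕ.∸ 9) ≡ + 3 ℤ.* δ ℤ.+ + 9 ℤ.* m
    +[3p∸9]≡3δ+9m = begin
      + (3 ℕ.* p ℕ.∸ 9)                    ≡⟨ ≡.cong +_ (ℕP.*-distribˡ-∸ 3 p 3) ⟨
      + (3 ℕ.* (p ℕ.∸ 3))                  ≡⟨ ℤP.pos-* 3 (p ℕ.∸ 3) ⟩
      + 3 ℤ.* + (p ℕ.∸ 3)                  ≡⟨ identity (+ (p ℕ.∸ 3)) m ⟩
      + 3 ℤ.* δ ℤ.+ + 9 ℤ.* m              ∎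
      where
      identity : ∀ P M → + 3 ℤ.* P ≡ + 3 ℤ.* (P ℤ.- + 3 ℤ.* M) ℤ.+ + 9 ℤ.* M
      identity = ℤSolver.solve-∀

  module NonNegative (N : ℕ) (δ≡N : δ ≡ + N) where

    N+3⊥n : Coprime (N ℕ.+ 3) n
    N+3⊥n = p-3m⊥n (+ 0) (begin
      + N ℤ.+ + 3                     ≡⟨ ≡.cong (ℤ._+ + 3) (≡.trans (≡.sym δ≡N) δ≡p-3m-3) ⟩
      p-3m ℤ.- + 3 ℤ.+ + 3            ≡⟨ identity p-3m (+ n) ⟩
      p-3m ℤ.+ + n ℤ.* + 0            ∎)
      where
      identity : ∀ C Nn → C ℤ.- + 3 ℤ.+ + 3 ≡ C ℤ.+ Nn ℤ.* + 0
      identity = ℤSolver.solve-∀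

    3∤N : ¬ 3 ∣ N
    3∤N 3∣N = 3≢1 (N+3⊥n (∣m∣n⇒∣m+n 3∣N ∣-refl , m∣m*n p))

    value : + (3 ℕ.* p ℕ.∸ 9) ℤ.- + 3 ℤ.* + N ≡ + 9 ℤ.* m
    value = begin
      + (3 ℕ.* p ℕ.∸ 9) ℤ.- + 3 ℤ.* + N          ≡⟨ ≡.cong₂ (λ x y → x ℤ.- + 3 ℤ.* y) +[3p∸9]≡3δ+9m (≡.sym δ≡N) ⟩
      + 3 ℤ.* δ ℤ.+ + 9 ℤ.* m ℤ.- + 3 ℤ.* δ      ≡⟨ identity δ m ⟩
      + 9 ℤ.* m                                  ∎
      where
      identity : ∀ D M → + 3 ℤ.* D ℤ.+ + 9 ℤ.* M ℤ.- + 3 ℤ.* D ≡ + 9 ℤ.* M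
      identity = ℤSolver.solve-∀

  module Negative (k : ℕ) (δ≡-k : δ ≡ ℤ.- + k) where

    -- A natural number congruent to 3 - k modulo n.
    cc : ℕ
    cc = 3 ℕ.+ (n ℕ.∸ 1) ℕ.* k

    k+cc≡3+nk : k ℕ.+ cc ≡ 3 ℕ.+ n ℕ.* k
    k+cc≡3+nk = shift n (ℕP.*-mono-≤ {1} {3} (ℕ.s≤s ℕ.z≤n) (ℕP.<-trans (ℕ.s≤s ℕ.z≤n) 3<p))
      where
      shift : ∀ N → 1 ℕ.≤ N → k ℕ.+ (3 ℕ.+ (N ℕ.∸ 1) ℕ.* k) ≡ 3 ℕ.+ N ℕ.* k
      shift (suc N) _ = identity N k
        where
        identity : ∀ N k → k ℕ.+ (3 ℕ.+ N ℕ.* k) ≡ 3 ℕ.+ (k ℕ.+ N ℕ.* k)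
        identity = solve-∀

    cc⊥n : Coprime cc n
    cc⊥n = p-3m⊥n (+ k) (begin
      + cc                                       ≡⟨ identity (+ k) (+ cc) ⟩
      (+ k ℤ.+ + cc) ℤ.+ ℤ.- + k                 ≡⟨ ≡.cong₂ ℤ._+_ k+cc≡3+nkℤ (≡.trans (≡.sym δ≡-k) δ≡p-3m-3) ⟩
      (+ 3 ℤ.+ + n ℤ.* + k) ℤ.+ (p-3m ℤ.- + 3)   ≡⟨ identity′ (+ n ℤ.* + k) p-3m ⟩
      p-3m ℤ.+ + n ℤ.* + k                       ∎)
      where
      k+cc≡3+nkℤ : + k ℤ.+ + cc ≡ + 3 ℤ.+ + n ℤ.* + k
      k+cc≡3+nkℤ = ≡.trans (≡.cong +_ k+cc≡3+nk) (≡.cong (λ x → + 3 ℤ.+ x) (ℤP.pos-* n k))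
      identity : ∀ K C → C ≡ (K ℤ.+ C) ℤ.+ ℤ.- K
      identity = ℤSolver.solve-∀
      identity′ : ∀ X C → (+ 3 ℤ.+ X) ℤ.+ (C ℤ.- + 3) ≡ C ℤ.+ X
      identity′ = ℤSolver.solve-∀

    3∤k : ¬ 3 ∣ k
    3∤k 3∣k = 3≢1 (cc⊥n (∣m∣n⇒∣m+n ∣-refl (∣n⇒∣m*n (n ℕ.∸ 1) 3∣k) , m∣m*n p))

    value : + (3 ℕ.* p ℕ.∸ 9) ℤ.+ + 3 ℤ.* + k ≡ + 9 ℤ.* m
    value = begin
      + (3 ℕ.* p ℕ.∸ 9) ℤ.+ + 3 ℤ.* + k            ≡⟨ ≡.cong₂ (λ x y → x ℤ.+ + 3 ℤ.* y) +[3p∸9]≡3δ+9m (≡.sym (ℤP.neg-involutive (+ k))) ⟩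
      + 3 ℤ.* δ ℤ.+ + 9 ℤ.* m ℤ.+ + 3 ℤ.* ℤ.- (ℤ.- + k) ≡⟨ ≡.cong (λ x → + 3 ℤ.* δ ℤ.+ + 9 ℤ.* m ℤ.+ + 3 ℤ.* ℤ.- x) (≡.sym δ≡-k) ⟩
      + 3 ℤ.* δ ℤ.+ + 9 ℤ.* m ℤ.+ + 3 ℤ.* ℤ.- δ     ≡⟨ identity δ m ⟩
      + 9 ℤ.* m                                    ∎
      where
      identity : ∀ D M → + 3 ℤ.* D ℤ.+ + 9 ℤ.* M ℤ.+ + 3 ℤ.* ℤ.- D ≡ + 9 ℤ.* M
      identity = ℤSolver.solve-∀

module IntegerImage {c ℓ : Level} (R : CommutativeRing c ℓ) where
  open CommutativeRing R
  open RawSemiringDefinitions (Semiring.rawSemiring semiring) using (_^_) renaming (_×_ to _·1_)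
  open import Relation.Binary.Reasoning.Setoid setoid
  open import Algebra.Properties.Ring ring using (-0#≈0#; -‿involutive; -‿+-comm; -‿distribˡ-*; -‿distribʳ-*)
  open import Algebra.Properties.Semiring.Mult semiring using (×1-homo-*)
  open import Algebra.Properties.Monoid.Mult +-monoid using (×-homo-+)

  ι-neg : ∀ a → ι R (ℤ.- a) ≈ - ι R a
  ι-neg (+ zero) = sym -0#≈0#
  ι-neg (+ suc n) = refl
  ι-neg -[1+ n ] = sym (-‿involutive _)

  private
    x≈x+y-y : ∀ x y → x ≈ (x + y) - y
    x≈x+y-y x y = begin
      x            ≈⟨ sym (+-identityʳ x) ⟩
      x + 0#       ≈⟨ +-congˡ (sym (-‿inverseʳ y)) ⟩
      x + (y - y)  ≈⟨ sym (+-assoc x y (- y)) ⟩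
      (x + y) - y  ∎

    -x≈y-[x+y] : ∀ x y → - x ≈ y - (x + y)
    -x≈y-[x+y] x y = begin
      - x             ≈⟨ sym (+-identityˡ (- x)) ⟩
      0# - x          ≈⟨ +-congʳ (sym (-‿inverseʳ y)) ⟩
      (y - y) - x     ≈⟨ +-assoc y (- y) (- x) ⟩
      y + (- y - x)   ≈⟨ +-congˡ (-‿+-comm y x) ⟩
      y - (y + x)     ≈⟨ +-congˡ (-‿cong (+-comm y x)) ⟩
      y - (x + y)     ∎

  ι-⊖ : ∀ a b → ι R (a ⊖ b) ≈ a ·1 1# - b ·1 1#
  ι-⊖ a b with ℕP.≤-<-connex b a
  ... | inj₁ b≤a = begin
    ι R (a ⊖ b)                             ≡⟨ ≡.cong (ι R) (ℤP.⊖-≥ b≤a) ⟩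
    (a ℕ.∸ b) ·1 1#                         ≈⟨ x≈x+y-y _ _ ⟩
    ((a ℕ.∸ b) ·1 1# + b ·1 1#) - b ·1 1#   ≈⟨ +-congʳ (sym (×-homo-+ 1# (a ℕ.∸ b) b)) ⟩
    (a ℕ.∸ b ℕ.+ b) ·1 1# - b ·1 1#         ≡⟨ ≡.cong (λ t → t ·1 1# - b ·1 1#) (ℕP.m∸n+n≡m b≤a) ⟩
    a ·1 1# - b ·1 1#                       ∎
  ... | inj₂ a<b = begin
    ι R (a ⊖ b)                             ≡⟨ ≡.cong (ι R) (ℤP.⊖-< a<b) ⟩
    ι R (ℤ.- (+ (b ℕ.∸ a)))                 ≈⟨ ι-neg (+ (b ℕ.∸ a)) ⟩
    - ((b ℕ.∸ a) ·1 1#)                     ≈⟨ -x≈y-[x+y] _ _ ⟩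
    a ·1 1# - ((b ℕ.∸ a) ·1 1# + a ·1 1#)   ≈⟨ +-congˡ (-‿cong (sym (×-homo-+ 1# (b ℕ.∸ a) a))) ⟩
    a ·1 1# - (b ℕ.∸ a ℕ.+ a) ·1 1#         ≡⟨ ≡.cong (λ t → a ·1 1# - t ·1 1#) (ℕP.m∸n+n≡m (ℕP.<⇒≤ a<b)) ⟩
    a ·1 1# - b ·1 1#                       ∎

  ι-+ : ∀ a b → ι R (a ℤ.+ b) ≈ ι R a + ι R b
  ι-+ (+ m) (+ n) = ×-homo-+ 1# m n
  ι-+ (+ m) -[1+ n ] = ι-⊖ m (suc n)
  ι-+ -[1+ m ] (+ n) = trans (ι-⊖ n (suc m)) (+-comm _ _)
  ι-+ -[1+ m ] -[1+ n ] = begin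
    - (suc (suc (m ℕ.+ n)) ·1 1#)        ≡⟨ ≡.cong (λ t → - (suc t ·1 1#)) (≡.sym (ℕP.+-suc m n)) ⟩
    - ((suc m ℕ.+ suc n) ·1 1#)          ≈⟨ -‿cong (×-homo-+ 1# (suc m) (suc n)) ⟩
    - (suc m ·1 1# + suc n ·1 1#)        ≈⟨ sym (-‿+-comm _ _) ⟩
    - (suc m ·1 1#) - suc n ·1 1#        ∎

  private
    ι-+◃ : ∀ k → ι R (Sign.+ ℤ.◃ k) ≈ k ·1 1#
    ι-+◃ k = reflexive (≡.cong (ι R) (ℤP.+◃n≡+n k))

    ι--◃ : ∀ k → ι R (Sign.- ℤ.◃ k) ≈ - (k ·1 1#)
    ι--◃ k = trans (reflexive (≡.cong (ι R) (ℤP.-◃n≡-n k))) (ι-neg (+ k))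

  ι-* : ∀ a b → ι R (a ℤ.* b) ≈ ι R a * ι R b
  ι-* (+ m) (+ n) = trans (ι-+◃ (m ℕ.* n)) (×1-homo-* m n)
  ι-* (+ m) -[1+ n ] =
    trans (ι--◃ (m ℕ.* suc n)) (trans (-‿cong (×1-homo-* m (suc n))) (-‿distribʳ-* _ _))
  ι-* -[1+ m ] (+ n) =
    trans (ι--◃ (suc m ℕ.* n)) (trans (-‿cong (×1-homo-* (suc m) n)) (-‿distribˡ-* _ _))
  ι-* -[1+ m ] -[1+ n ] =
    trans (ι-+◃ (suc m ℕ.* suc n)) (trans (×1-homo-* (suc m) (suc n))
      (trans (sym (-‿involutive _)) (trans (-‿cong (-‿distribˡ-* _ _)) (-‿distribʳ-* _ _))))

  ι-^ : ∀ q a → ι R (+ (q ℕ.^ a)) ≈ ι R (+ q) ^ a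
  ι-^ q zero = +-identityʳ 1#
  ι-^ q (suc a) = trans (×1-homo-* q (q ℕ.^ a)) (*-congˡ (ι-^ q a))

  -- The solver needs the image of 1 to be 1# on the nose, while ι (+ 1) is 1# + 0#.
  private
    ι′ : ℤ → Carrier
    ι′ (+ 1) = 1#
    ι′ a = ι R a

    ι′≈ι : ∀ a → ι′ a ≈ ι R a
    ι′≈ι (+ zero) = refl
    ι′≈ι (+ suc zero) = sym (+-identityʳ 1#)
    ι′≈ι (+ suc (suc n)) = refl
    ι′≈ι -[1+ n ] = refl

    ι′-morphism : ℤ.+-*-rawRing ACR.-Raw-AlmostCommutative⟶ ACR.fromCommutativeRing R
    ι′-morphism = record
      { ⟦_⟧ = ι′
      ; +-homo = λ a b → trans (ι′≈ι (a ℤ.+ b)) (trans (ι-+ a b) (sym (+-cong (ι′≈ι a) (ι′≈ι b))))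
      ; *-homo = λ a b → trans (ι′≈ι (a ℤ.* b)) (trans (ι-* a b) (sym (*-cong (ι′≈ι a) (ι′≈ι b))))
      ; -‿homo = λ a → trans (ι′≈ι (ℤ.- a)) (trans (ι-neg a) (sym (-‿cong (ι′≈ι a))))
      ; 0-homo = refl
      ; 1-homo = refl
      }

    ι′-≟ : ∀ a b → Maybe (ι′ a ≈ ι′ b)
    ι′-≟ a b with a ℤ.≟ b
    ... | yes ≡.refl = just refl
    ... | no _ = nothing

  open RingSolver ℤ.+-*-rawRing (ACR.fromCommutativeRing R) ι′-morphism ι′-≟ public
    using (solve; _:=_; _:+_; _:*_; :-_; _:-_; con; _:^_)

module Powers {c ℓ : Level} (R : CommutativeRing c ℓ) where
  open import Data.Nat.DivMod
  open import Data.Nat.Divisibility using (_∣_; m%n≡0⇒n∣m)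
  open CommutativeRing R
  open RawSemiringDefinitions (Semiring.rawSemiring semiring) using (_^_)
  open import Relation.Binary.Reasoning.Setoid setoid
  open import Algebra.Properties.Semiring.Exp semiring using (^-homo-*; ^-assocʳ; ^-congˡ)
  open import Algebra.Properties.CommutativeSemiring.Exp commutativeSemiring using (^-distrib-*)
  open IntegerImage R

  1#^ : ∀ k → 1# ^ k ≈ 1#
  1#^ zero = refl
  1#^ (suc k) = trans (*-identityˡ _) (1#^ k)

  ^≈^-% : ∀ {x} r .{{_ : ℕ.NonZero r}} → x ^ r ≈ 1# → ∀ a → x ^ a ≈ x ^ (a % r)
  ^≈^-% {x} r xʳ≈1 a = begin
    x ^ a                                          ≡⟨ ≡.cong (x ^_) (m≡m%n+[m/n]*n a r) ⟩
    x ^ (a % r ℕ.+ (a ℕ./ r) ℕ.* r)                ≈⟨ ^-homo-* x (a % r) _ ⟩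
    x ^ (a % r) * x ^ ((a ℕ./ r) ℕ.* r)            ≡⟨ ≡.cong (λ t → x ^ (a % r) * x ^ t) (ℕP.*-comm (a ℕ./ r) r) ⟩
    x ^ (a % r) * x ^ (r ℕ.* (a ℕ./ r))            ≈⟨ *-congˡ (sym (^-assocʳ x r (a ℕ./ r))) ⟩
    x ^ (a % r) * (x ^ r) ^ (a ℕ./ r)              ≈⟨ *-congˡ (trans (^-congˡ (a ℕ./ r) xʳ≈1) (1#^ (a ℕ./ r))) ⟩
    x ^ (a % r) * 1#                               ≈⟨ *-identityʳ _ ⟩
    x ^ (a % r)                                    ∎

  cube-root-norm : ∀ {z} N → z ^ 3 ≈ 1# → ¬ 3 ∣ N → (z ^ N - 1#) * ((z * z) ^ N - 1#) ≈ (z - 1#) * (z * z - 1#)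
  cube-root-norm {z} N z³≈1 3∤N
    with N % 3 | ^≈^-% 3 z³≈1 N | m%n<n N 3 | m%n≡0⇒n∣m N 3
  ... | 0 | _ | _ | 3∣N = ⊥-elim (3∤N (3∣N ≡.refl))
  ... | 1 | zᴺ≈z¹ | _ | _ = begin
    (z ^ N - 1#) * ((z * z) ^ N - 1#)          ≈⟨ *-congˡ (+-congʳ (^-distrib-* z z N)) ⟩
    (z ^ N - 1#) * (z ^ N * z ^ N - 1#)        ≈⟨ *-cong (+-congʳ zᴺ≈z) (+-congʳ (*-cong zᴺ≈z zᴺ≈z)) ⟩
    (z - 1#) * (z * z - 1#)                    ∎
    where zᴺ≈z = trans zᴺ≈z¹ (*-identityʳ z)
  ... | 2 | zᴺ≈z² | _ | _ = begin
    (z ^ N - 1#) * ((z * z) ^ N - 1#)                        ≈⟨ *-congˡ (+-congʳ (^-distrib-* z z N)) ⟩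
    (z ^ N - 1#) * (z ^ N * z ^ N - 1#)                      ≈⟨ *-cong (+-congʳ zᴺ≈zz) (+-congʳ (*-cong zᴺ≈zz zᴺ≈zz)) ⟩
    (z * z - 1#) * ((z * z) * (z * z) - 1#)                  ≈⟨ solve 1 (λ Z → (Z :* Z :- con (+ 1)) :* ((Z :* Z) :* (Z :* Z) :- con (+ 1))
                                                                   := (Z :- con (+ 1)) :* (Z :* Z :- con (+ 1))
                                                                      :+ ((Z :* Z :- con (+ 1)) :* Z) :* (Z :* (Z :* (Z :* con (+ 1))) :- con (+ 1)))
                                                                 refl z ⟩
    (z - 1#) * (z * z - 1#) + ((z * z - 1#) * z) * (z ^ 3 - 1#) ≈⟨ +-congˡ (*-congˡ (trans (+-congʳ z³≈1) (-‿inverseʳ 1#))) ⟩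
    (z - 1#) * (z * z - 1#) + ((z * z - 1#) * z) * 0#        ≈⟨ trans (+-congˡ (zeroʳ _)) (+-identityʳ _) ⟩
    (z - 1#) * (z * z - 1#)                                  ∎
    where zᴺ≈zz = trans zᴺ≈z² (*-congˡ (*-identityʳ z))
  ... | suc (suc (suc _)) | _ | ℕ.s≤s (ℕ.s≤s (ℕ.s≤s ())) | _

module Evaluation {c ℓ : Level} (R : CommutativeRing c ℓ) where
  open CommutativeRing R
  open RawSemiringDefinitions (Semiring.rawSemiring semiring) using (_^_)
  open import Relation.Binary.Reasoning.Setoid setoid
  open import Algebra.Properties.Semiring.Exp semiring using (^-homo-*)
  open import Algebra.Properties.Ring ring using (-0#≈0#)
  open IntegerImage R

  eval-cong : ∀ P {x y} → x ≈ y → eval R P x ≈ eval R P y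
  eval-cong [] x≈y = refl
  eval-cong (a ∷ P) x≈y = +-congˡ (*-cong x≈y (eval-cong P x≈y))

  eval-+ : ∀ P Q x → eval R (P +ₚ Q) x ≈ eval R P x + eval R Q x
  eval-+ [] Q x = sym (+-identityˡ _)
  eval-+ (a ∷ P) [] x = sym (+-identityʳ _)
  eval-+ (a ∷ P) (b ∷ Q) x = begin
    ι R (a ℤ.+ b) + x * eval R (P +ₚ Q) x            ≈⟨ +-cong (ι-+ a b) (*-congˡ (eval-+ P Q x)) ⟩
    (ι R a + ι R b) + x * (eval R P x + eval R Q x)  ≈⟨ solve 5 (λ A B X P Q → (A :+ B) :+ X :* (P :+ Q) := (A :+ X :* P) :+ (B :+ X :* Q))
                                                         refl (ι R a) (ι R b) x (eval R P x) (eval R Q x) ⟩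
    (ι R a + x * eval R P x) + (ι R b + x * eval R Q x) ∎

  eval-negₚ : ∀ P x → eval R (negₚ P) x ≈ - eval R P x
  eval-negₚ [] x = sym -0#≈0#
  eval-negₚ (a ∷ P) x = begin
    ι R (ℤ.- a) + x * eval R (negₚ P) x  ≈⟨ +-cong (ι-neg a) (*-congˡ (eval-negₚ P x)) ⟩
    - ι R a + x * (- eval R P x)         ≈⟨ solve 3 (λ A X P → :- A :+ X :* (:- P) := :- (A :+ X :* P)) refl (ι R a) x (eval R P x) ⟩
    - (ι R a + x * eval R P x)           ∎

  eval-- : ∀ P Q x → eval R (P -ₚ Q) x ≈ eval R P x - eval R Q x
  eval-- P Q x = trans (eval-+ P (negₚ Q) x) (+-congˡ (eval-negₚ Q x))

  eval-scaleₚ : ∀ a P x → eval R (scaleₚ a P) x ≈ ι R a * eval R P x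
  eval-scaleₚ a [] x = sym (zeroʳ _)
  eval-scaleₚ a (b ∷ P) x = begin
    ι R (a ℤ.* b) + x * eval R (scaleₚ a P) x  ≈⟨ +-cong (ι-* a b) (*-congˡ (eval-scaleₚ a P x)) ⟩
    ι R a * ι R b + x * (ι R a * eval R P x)   ≈⟨ solve 4 (λ A B X P → A :* B :+ X :* (A :* P) := A :* (B :+ X :* P))
                                                   refl (ι R a) (ι R b) x (eval R P x) ⟩
    ι R a * (ι R b + x * eval R P x)           ∎

  eval-* : ∀ P Q x → eval R (P *ₚ Q) x ≈ eval R P x * eval R Q x
  eval-* [] Q x = sym (zeroˡ _)
  eval-* (a ∷ P) Q x = begin
    eval R (scaleₚ a Q +ₚ (+ 0 ∷ P *ₚ Q)) x              ≈⟨ eval-+ (scaleₚ a Q) _ x ⟩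
    eval R (scaleₚ a Q) x + (0# + x * eval R (P *ₚ Q) x) ≈⟨ +-cong (eval-scaleₚ a Q x) (+-congˡ (*-congˡ (eval-* P Q x))) ⟩
    ι R a * eval R Q x + (0# + x * (eval R P x * eval R Q x))
      ≈⟨ solve 4 (λ A Q X P → A :* Q :+ (con (+ 0) :+ X :* (P :* Q)) := (A :+ X :* P) :* Q)
           refl (ι R a) (eval R Q x) x (eval R P x) ⟩
    (ι R a + x * eval R P x) * eval R Q x                ∎

  eval-oneₚ : ∀ x → eval R oneₚ x ≈ 1#
  eval-oneₚ x = trans (+-cong (+-identityʳ 1#) (zeroʳ x)) (+-identityʳ 1#)

  eval-X^ : ∀ k x → eval R (X^ k) x ≈ x ^ k
  eval-X^ zero x = eval-oneₚ x
  eval-X^ (suc k) x = trans (+-identityˡ _) (*-congˡ (eval-X^ k x))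

  eval-T₃ : ∀ x → eval R T₃ x ≈ 1# + x ^ 3 + x ^ 6
  eval-T₃ x = begin
    eval R (X^ 0 +ₚ X^ 3 +ₚ X^ 6) x                    ≈⟨ eval-+ (X^ 0 +ₚ X^ 3) (X^ 6) x ⟩
    eval R (X^ 0 +ₚ X^ 3) x + eval R (X^ 6) x          ≈⟨ +-cong (eval-+ (X^ 0) (X^ 3) x) (eval-X^ 6 x) ⟩
    eval R (X^ 0) x + eval R (X^ 3) x + x ^ 6          ≈⟨ +-congʳ (+-cong (eval-X^ 0 x) (eval-X^ 3 x)) ⟩
    1# + x ^ 3 + x ^ 6                                 ∎

  eval-T₃-cube-root : ∀ x → x ^ 3 ≈ 1# → eval R T₃ x ≈ ι R (+ 3)
  eval-T₃-cube-root x x³≈1 = begin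
    eval R T₃ x                   ≈⟨ eval-T₃ x ⟩
    1# + x ^ 3 + x ^ 6            ≈⟨ +-congˡ (^-homo-* x 3 3) ⟩
    1# + x ^ 3 + x ^ 3 * x ^ 3    ≈⟨ +-cong (+-congˡ x³≈1) (*-cong x³≈1 x³≈1) ⟩
    1# + 1# + 1# * 1#             ≈⟨ solve 0 (con (+ 1) :+ con (+ 1) :+ con (+ 1) :* con (+ 1) := con (+ 3)) refl ⟩
    ι R (+ 3)                     ∎

  eval-geom-*-x-1 : ∀ k x → eval R (geom k) x * (x - 1#) ≈ x ^ k - 1#
  eval-geom-*-x-1 zero x = trans (zeroˡ _) (sym (-‿inverseʳ 1#))
  eval-geom-*-x-1 (suc k) x = begin
    (ι R (+ 1) + x * eval R (geom k) x) * (x - 1#)  ≈⟨ *-congʳ (+-congʳ (+-identityʳ 1#)) ⟩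
    (1# + x * G) * (x - 1#)                         ≈⟨ solve 2 (λ X G → (con (+ 1) :+ X :* G) :* (X :- con (+ 1))
                                                                   := (X :- con (+ 1)) :+ X :* (G :* (X :- con (+ 1)))) refl x G ⟩
    (x - 1#) + x * (G * (x - 1#))                   ≈⟨ +-congˡ (*-congˡ (eval-geom-*-x-1 k x)) ⟩
    (x - 1#) + x * (x ^ k - 1#)                     ≈⟨ solve 2 (λ X P → (X :- con (+ 1)) :+ X :* (P :- con (+ 1)) := X :* P :- con (+ 1))
                                                         refl x (x ^ k) ⟩
    x * x ^ k - 1#                                  ∎
    where G = eval R (geom k) x

  eval-geom-1 : ∀ k → eval R (geom k) 1# ≈ ι R (+ k)
  eval-geom-1 zero = refl
  eval-geom-1 (suc k) = +-cong (+-identityʳ 1#) (trans (*-identityˡ _) (eval-geom-1 k))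

module Products {c ℓ : Level} (R : CommutativeRing c ℓ) where
  open import Data.Nat.Divisibility using (_∣_; _∣?_; ∣⇒≤; ∣m+n∣m⇒∣n; ∣m∣n⇒∣m+n; n∣m*n; ∣-refl)
  open CommutativeRing R
  open RawSemiringDefinitions (Semiring.rawSemiring semiring) using (_^_)
  open Evaluation R

  -- Π n f = f n * … * f 1, the shape in which M unfolds.
  Π : ℕ → (ℕ → Carrier) → Carrier
  Π zero f = 1#
  Π (suc j) f = f (suc j) * Π j f

  Π-cong : ∀ n {f g} → (∀ j → f j ≈ g j) → Π n f ≈ Π n g
  Π-cong zero f≈g = refl
  Π-cong (suc n) f≈g = *-cong (f≈g (suc n)) (Π-cong n f≈g)

  Π-distrib-* : ∀ n f g → Π n (λ j → f j * g j) ≈ Π n f * Π n g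
  Π-distrib-* zero f g = sym (*-identityʳ 1#)
  Π-distrib-* (suc n) f g = trans (*-congˡ (Π-distrib-* n f g))
    (solve 4 (λ A B C D → (A :* B) :* (C :* D) := (A :* C) :* (B :* D)) refl (f (suc n)) (g (suc n)) (Π n f) (Π n g))
    where open IntegerImage R

  Π-+ : ∀ b a f → Π (b ℕ.+ a) f ≈ Π b (λ i → f (i ℕ.+ a)) * Π a f
  Π-+ zero a f = sym (*-identityˡ _)
  Π-+ (suc b) a f = trans (*-congˡ (Π-+ b a f)) (sym (*-assoc _ _ _))

  Π-≈1 : ∀ m {f} → (∀ j → j ℕ.< m → f (suc j) ≈ 1#) → Π m f ≈ 1#
  Π-≈1 zero f≈1 = refl
  Π-≈1 (suc m) f≈1 = trans (*-cong (f≈1 m (ℕP.n<1+n m)) (Π-≈1 m (λ j j<m → f≈1 j (ℕP.m<n⇒m<1+n j<m))))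
                            (*-identityʳ 1#)

  offMultiples : ℕ → (ℕ → Carrier) → ℕ → Carrier
  offMultiples d f j with d ∣? j
  ... | yes _ = 1#
  ... | no _ = f j

  onMultiples : ℕ → (ℕ → Carrier) → ℕ → Carrier
  onMultiples d f j with d ∣? j
  ... | yes _ = f j
  ... | no _ = 1#

  onMultiples-∣ : ∀ d f j → d ∣ j → onMultiples d f j ≈ f j
  onMultiples-∣ d f j d∣j with d ∣? j
  ... | yes _ = refl
  ... | no d∤j = ⊥-elim (d∤j d∣j)

  onMultiples-∤ : ∀ d f j → ¬ d ∣ j → onMultiples d f j ≈ 1#
  onMultiples-∤ d f j d∤j with d ∣? j
  ... | yes d∣j = ⊥-elim (d∤j d∣j)
  ... | no _ = refl

  Π-on*off : ∀ m d f → Π m f ≈ Π m (onMultiples d f) * Π m (offMultiples d f)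
  Π-on*off m d f = trans (Π-cong m split) (Π-distrib-* m _ _)
    where
    split : ∀ j → f j ≈ onMultiples d f j * offMultiples d f j
    split j with d ∣? j
    ... | yes _ = sym (*-identityʳ _)
    ... | no _ = sym (*-identityˡ _)

  Π-off-* : ∀ m d f g → Π m (offMultiples d (λ j → f j * g j)) ≈ Π m (offMultiples d f) * Π m (offMultiples d g)
  Π-off-* m d f g = trans (Π-cong m off-*) (Π-distrib-* m _ _)
    where
    off-* : ∀ j → offMultiples d (λ j → f j * g j) j ≈ offMultiples d f j * offMultiples d g j
    off-* j with d ∣? j
    ... | yes _ = sym (*-identityʳ _)
    ... | no _ = refl

  Π-off-cong : ∀ m d {f g} → (∀ j → ¬ d ∣ j → f j ≈ g j) → Π m (offMultiples d f) ≈ Π m (offMultiples d g)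
  Π-off-cong m d {f} {g} f≈g = Π-cong m off-cong
    where
    off-cong : ∀ j → offMultiples d f j ≈ offMultiples d g j
    off-cong j with d ∣? j
    ... | yes _ = refl
    ... | no d∤j = f≈g j d∤j

  Π-on : ∀ d q f → 0 ℕ.< d → Π (q ℕ.* d) (onMultiples d f) ≈ Π q (λ i → f (i ℕ.* d))
  Π-on d zero f _ = refl
  Π-on d@(suc d-1) (suc q) f 0<d = begin
    Π (d ℕ.+ q ℕ.* d) (onMultiples d f)
      ≈⟨ Π-+ d (q ℕ.* d) (onMultiples d f) ⟩
    Π d (λ i → onMultiples d f (i ℕ.+ q ℕ.* d)) * Π (q ℕ.* d) (onMultiples d f)
      ≈⟨ *-cong block (Π-on d q f 0<d) ⟩
    f (d ℕ.+ q ℕ.* d) * Π q (λ i → f (i ℕ.* d))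
      ∎
    where
    open import Relation.Binary.Reasoning.Setoid setoid
    d∤ : ∀ j → j ℕ.< d-1 → ¬ d ∣ suc j ℕ.+ q ℕ.* d
    d∤ j j<d-1 d∣ = ℕP.<⇒≱ (ℕ.s≤s j<d-1)
      (∣⇒≤ (∣m+n∣m⇒∣n (≡.subst (d ∣_) (ℕP.+-comm (suc j) (q ℕ.* d)) d∣) (n∣m*n q)))
    block : Π d (λ i → onMultiples d f (i ℕ.+ q ℕ.* d)) ≈ f (d ℕ.+ q ℕ.* d)
    block = trans (*-cong (onMultiples-∣ d f _ (∣m∣n⇒∣m+n ∣-refl (n∣m*n q)))
                          (Π-≈1 d-1 (λ j j<d-1 → onMultiples-∤ d f _ (d∤ j j<d-1))))
                  (*-identityʳ _)

  M≈Π : ∀ n ω F → M R n ω F ≈ Π n (λ j → eval R F (ω ^ j))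
  M≈Π zero ω F = refl
  M≈Π (suc n) ω F = *-congˡ (M≈Π n ω F)

  M-* : ∀ n ω F G → M R n ω (F *ₚ G) ≈ M R n ω F * M R n ω G
  M-* n ω F G = trans (M≈Π n ω (F *ₚ G)) (trans (Π-cong n (λ j → eval-* F G (ω ^ j)))
    (trans (Π-distrib-* n _ _) (sym (*-cong (M≈Π n ω F) (M≈Π n ω G)))))

  M-oneₚ : ∀ n ω → M R n ω oneₚ ≈ 1#
  M-oneₚ zero ω = refl
  M-oneₚ (suc n) ω = trans (*-cong (eval-oneₚ _) (M-oneₚ n ω)) (*-identityˡ 1#)

  M-^ₚ : ∀ n ω F a → M R n ω (F ^ₚ a) ≈ M R n ω F ^ a
  M-^ₚ n ω F zero = M-oneₚ n ω
  M-^ₚ n ω F (suc a) = trans (M-* n ω F (F ^ₚ a)) (*-congˡ (M-^ₚ n ω F a))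

module RootsOfUnity {c ℓ : Level} (R : CommutativeRing c ℓ) (D : CharZeroDomain R)
                    (n : ℕ) (n≥2 : 2 ℕ.≤ n) (ω : CommutativeRing.Carrier R)
                    (ω-primitive : PrimitiveRoot R n ω) where
  open import Data.Nat.DivMod
  open import Data.Nat.Divisibility
  open import Data.Nat.Coprimality using (coprime-divisor)
  open import Data.Fin using (toℕ)
  import Data.Fin.Properties as FinP
  open Arithmetic
  open CommutativeRing R
  open RawSemiringDefinitions (Semiring.rawSemiring semiring) using (_^_)
  open import Relation.Binary.Reasoning.Setoid setoid
  open import Algebra.Properties.Semiring.Exp semiring using (^-homo-*; ^-assocʳ; ^-congˡ)
  open import Algebra.Properties.Semiring.Mult semiring using (×1-homo-*)
  open import Algebra.Properties.CommutativeSemiring.Exp commutativeSemiring using (^-distrib-*)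
  open import Algebra.Properties.CommutativeMonoid.Sum *-commutativeMonoid
    using (sum-permute; sum-cong-≋) renaming (sum to ∏)
  open CharZeroDomain D
  open PrimitiveRoot ω-primitive
  open IntegerImage R
  open Powers R
  open Evaluation R
  open Products R

  instance
    n≢0 : ℕ.NonZero n
    n≢0 = ℕ.>-nonZero (ℕP.<-≤-trans (ℕ.s≤s ℕ.z≤n) n≥2)

  *-≉0 : ∀ {x y} → ¬ x ≈ 0# → ¬ y ≈ 0# → ¬ x * y ≈ 0#
  *-≉0 x≉0 y≉0 xy≈0 = [ x≉0 , y≉0 ]′ (noZeroDivisors _ _ xy≈0)

  *-cancelˡ : ∀ {a x y} → ¬ a ≈ 0# → a * x ≈ a * y → x ≈ y
  *-cancelˡ {a} {x} {y} a≉0 ax≈ay with noZeroDivisors a (x - y)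
    (trans (solve 3 (λ A X Y → A :* (X :- Y) := A :* X :- A :* Y) refl a x y)
           (trans (+-congʳ ax≈ay) (-‿inverseʳ _)))
  ... | inj₁ a≈0 = ⊥-elim (a≉0 a≈0)
  ... | inj₂ x-y≈0 = trans (solve 2 (λ X Y → X := (X :- Y) :+ Y) refl x y) (trans (+-congʳ x-y≈0) (+-identityˡ y))

  x-1≉0 : ∀ {x} → ¬ x ≈ 1# → ¬ x - 1# ≈ 0#
  x-1≉0 {x} x≉1 x-1≈0 =
    x≉1 (trans (solve 1 (λ X → X := (X :- con (+ 1)) :+ con (+ 1)) refl x) (trans (+-congʳ x-1≈0) (+-identityˡ 1#)))

  1-x≉0 : ∀ {x} → ¬ x ≈ 1# → ¬ 1# - x ≈ 0#
  1-x≉0 {x} x≉1 1-x≈0 =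
    x≉1 (sym (trans (solve 1 (λ X → con (+ 1) := (con (+ 1) :- X) :+ X) refl x) (trans (+-congʳ 1-x≈0) (+-identityˡ x))))

  ω^≈ω^-% : ∀ a → ω ^ a ≈ ω ^ (a % n)
  ω^≈ω^-% = ^≈^-% n root

  %-≡⇒ω^≈ : ∀ {a b} → a % n ≡ b % n → ω ^ a ≈ ω ^ b
  %-≡⇒ω^≈ {a} {b} eq = trans (ω^≈ω^-% a) (trans (reflexive (≡.cong (ω ^_) eq)) (sym (ω^≈ω^-% b)))

  ∣⇒ω^≈1 : ∀ {a} → n ∣ a → ω ^ a ≈ 1#
  ∣⇒ω^≈1 {a} n∣a = trans (ω^≈ω^-% a) (reflexive (≡.cong (ω ^_) (n∣m⇒m%n≡0 a n n∣a)))

  ω^≈1⇒∣ : ∀ a → ω ^ a ≈ 1# → n ∣ a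
  ω^≈1⇒∣ a ωᵃ≈1 with a % n ℕ.≟ 0
  ... | yes a%n≡0 = m%n≡0⇒n∣m a n a%n≡0
  ... | no a%n≢0 = ⊥-elim (isPrimitive (a % n) (ℕP.n≢0⇒n>0 a%n≢0) (m%n<n a n)
                                       (trans (sym (ω^≈ω^-% a)) ωᵃ≈1))

  [ω^j]^n≈1 : ∀ j → (ω ^ j) ^ n ≈ 1#
  [ω^j]^n≈1 j = trans (^-assocʳ ω j n) (∣⇒ω^≈1 (n∣m*n j))

  ω^≉0 : ∀ a → ¬ ω ^ a ≈ 0#
  ω^≉0 a ωᵃ≈0 = nontrivial (begin
    1#                              ≈⟨ sym (∣⇒ω^≈1 (n∣m*n a)) ⟩
    ω ^ (a ℕ.* n)                   ≈⟨ sym (^-assocʳ ω a n) ⟩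
    (ω ^ a) ^ n                     ≈⟨ ^-congˡ n ωᵃ≈0 ⟩
    0# ^ n                          ≈⟨ 0#^n (ℕP.<-≤-trans (ℕ.s≤s ℕ.z≤n) n≥2) ⟩
    0#                              ∎)
    where
    0#^n : ∀ {k} → 0 ℕ.< k → 0# ^ k ≈ 0#
    0#^n {suc k} _ = zeroˡ _

  Periodic : (ℕ → Carrier) → Set ℓ
  Periodic f = ∀ j → f j ≈ f (j % n)

  periodic : ∀ (g : Carrier → Carrier) → (∀ {x y} → x ≈ y → g x ≈ g y) → Periodic (λ j → g (ω ^ j))
  periodic g g-cong j = g-cong (ω^≈ω^-% j)

  private
    ∏[<_] : ℕ → (ℕ → Carrier) → Carrier
    ∏[< m ] f = ∏ {m} (λ i → f (toℕ i))

    ∏-snoc : ∀ m f → ∏[< suc m ] f ≈ ∏[< m ] f * f m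
    ∏-snoc zero f = *-comm _ _
    ∏-snoc (suc m) f = trans (*-congˡ (∏-snoc m (λ j → f (suc j)))) (sym (*-assoc _ _ _))

    Π≈∏-suc : ∀ m f → Π m f ≈ ∏[< m ] (λ j → f (suc j))
    Π≈∏-suc zero f = refl
    Π≈∏-suc (suc m) f = trans (*-congˡ (Π≈∏-suc m f)) (trans (*-comm _ _) (sym (∏-snoc m (λ j → f (suc j)))))

    Π≈∏ : ∀ m f → f m ≈ f 0 → Π m f ≈ ∏[< m ] f
    Π≈∏ zero f _ = refl
    Π≈∏ (suc m) f fm≈f0 = begin
      Π (suc m) f                              ≈⟨ Π≈∏-suc (suc m) f ⟩
      ∏[< suc m ] (λ j → f (suc j))            ≈⟨ ∏-snoc m (λ j → f (suc j)) ⟩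
      ∏[< m ] (λ j → f (suc j)) * f (suc m)    ≈⟨ *-comm _ _ ⟩
      f (suc m) * ∏[< m ] (λ j → f (suc j))    ≈⟨ *-congʳ fm≈f0 ⟩
      ∏[< suc m ] f                            ∎

  Π-∘-* : ∀ k → Coprime k n → ∀ f → Periodic f → Π n (λ j → f (k ℕ.* j)) ≈ Π n f
  Π-∘-* k k⊥n f f-periodic with coprime⇒∃-inverse-mod n≥2 k⊥n
  ... | k′ , k′k≡1 = begin
    Π n (λ j → f (k ℕ.* j))     ≈⟨ Π≈∏ n _ (f-≡% (≡.trans (m*n%n≡0 k n) (≡.sym (≡.trans (≡.cong (_% n) (ℕP.*-zeroʳ k)) 0%n≡0)))) ⟩
    ∏[< n ] (λ j → f (k ℕ.* j)) ≈⟨ sym (trans (sum-permute (λ i → f (toℕ i)) (*-permutation k k′ k′k≡1))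
                                      (sum-cong-≋ {n} (λ i → trans (reflexive (≡.cong f (FinP.toℕ-fromℕ< _)))
                                                                   (sym (f-periodic (k ℕ.* toℕ i)))))) ⟩
    ∏[< n ] f                   ≈⟨ sym (Π≈∏ n f (f-≡% (≡.trans (n%n≡0 n) (≡.sym 0%n≡0)))) ⟩
    Π n f                       ∎
    where
    0%n≡0 : 0 % n ≡ 0
    0%n≡0 = m*n%n≡0 0 n
    f-≡% : ∀ {a b} → a % n ≡ b % n → f a ≈ f b
    f-≡% {a} {b} eq = trans (f-periodic a) (trans (reflexive (≡.cong f eq)) (sym (f-periodic b)))

  Π-≉0 : ∀ m f → (∀ j → ¬ f (suc j) ≈ 0#) → ¬ Π m f ≈ 0#
  Π-≉0 zero f f≉0 = nontrivial
  Π-≉0 (suc m) f f≉0 = *-≉0 (f≉0 m) (Π-≉0 m f f≉0)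

  Π-off-≉0 : ∀ d f → (∀ j → ¬ d ∣ j → ¬ f j ≈ 0#) → ¬ Π n (offMultiples d f) ≈ 0#
  Π-off-≉0 d f f≉0 = Π-≉0 n (offMultiples d f) (λ j → off-≉0 (suc j))
    where
    off-≉0 : ∀ j → ¬ offMultiples d f j ≈ 0#
    off-≉0 j with d ∣? j
    ... | yes _ = nontrivial
    ... | no d∤j = f≉0 j d∤j

  Π-off-∘-* : ∀ d k f → d ∣ n → Coprime k n → Periodic f →
              Π n (offMultiples d (λ j → f (k ℕ.* j))) ≈ Π n (offMultiples d f)
  Π-off-∘-* d k f d∣n k⊥n f-periodic =
    trans (Π-cong n commute) (Π-∘-* k k⊥n (offMultiples d f) off-periodic)
    where
    k⊥d : Coprime k d
    k⊥d (i∣k , i∣d) = k⊥n (i∣k , ∣-trans i∣d d∣n)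
    commute : ∀ j → offMultiples d (λ j → f (k ℕ.* j)) j ≈ offMultiples d f (k ℕ.* j)
    commute j with d ∣? j | d ∣? (k ℕ.* j)
    ... | yes _ | yes _ = refl
    ... | no _ | no _ = refl
    ... | yes d∣j | no d∤kj = ⊥-elim (d∤kj (∣n⇒∣m*n k d∣j))
    ... | no d∤j | yes d∣kj = ⊥-elim (d∤j (coprime-divisor (Coprimality.sym k⊥d) d∣kj))
    off-periodic : Periodic (offMultiples d f)
    off-periodic j with d ∣? j | d ∣? (j % n)
    ... | yes _ | yes _ = refl
    ... | no _ | no _ = f-periodic j
    ... | yes d∣j | no d∤j%n = ⊥-elim (d∤j%n (%-presˡ-∣ d∣j d∣n))
    ... | no d∤j | yes d∣j%n = ⊥-elim (d∤j (∣n∣m%n⇒∣m d∣n d∣j%n))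

  Π-off≈1 : ∀ d u v w → (∀ j → ¬ d ∣ j → ¬ v j ≈ 0#) → (∀ j → ¬ d ∣ j → u j * v j ≈ w j) →
            Π n (offMultiples d w) ≈ Π n (offMultiples d v) → Π n (offMultiples d u) ≈ 1#
  Π-off≈1 d u v w v≉0 uv≈w Πw≈Πv = *-cancelˡ (Π-off-≉0 d v v≉0) (begin
    Π n (offMultiples d v) * Π n (offMultiples d u)   ≈⟨ *-comm _ _ ⟩
    Π n (offMultiples d u) * Π n (offMultiples d v)   ≈⟨ sym (Π-off-* n d u v) ⟩
    Π n (offMultiples d (λ j → u j * v j))            ≈⟨ Π-off-cong n d uv≈w ⟩
    Π n (offMultiples d w)                            ≈⟨ Πw≈Πv ⟩
    Π n (offMultiples d v)                            ≈⟨ sym (*-identityʳ _) ⟩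
    Π n (offMultiples d v) * 1#                       ∎)

  M-geom : ∀ q → Coprime q n → M R n ω (geom q) ≈ ι R (+ q)
  M-geom q q⊥n = begin
    M R n ω (geom q)                                      ≈⟨ M≈Π n ω (geom q) ⟩
    Π n u                                                 ≈⟨ Π-on*off n n u ⟩
    Π n (onMultiples n u) * Π n (offMultiples n u)        ≈⟨ *-cong on off ⟩
    u (1 ℕ.* n) * 1#                                      ≈⟨ *-identityʳ _ ⟩
    eval R (geom q) (ω ^ (1 ℕ.* n))                       ≈⟨ eval-cong (geom q) (∣⇒ω^≈1 (n∣m*n 1)) ⟩
    eval R (geom q) 1#                                    ≈⟨ eval-geom-1 q ⟩
    ι R (+ q)                                             ∎
    where
    u v : ℕ → Carrier
    u j = eval R (geom q) (ω ^ j)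
    v j = ω ^ j - 1#
    on : Π n (onMultiples n u) ≈ u (1 ℕ.* n)
    on = trans (reflexive (≡.cong (λ m → Π m (onMultiples n u)) (≡.sym (ℕP.*-identityˡ n))))
               (trans (Π-on n 1 u (ℕP.<-≤-trans (ℕ.s≤s ℕ.z≤n) n≥2)) (*-identityʳ _))
    uv≈v∘q : ∀ j → ¬ n ∣ j → u j * v j ≈ v (q ℕ.* j)
    uv≈v∘q j _ = trans (eval-geom-*-x-1 q (ω ^ j)) (+-congʳ (trans (^-assocʳ ω j q) (reflexive (≡.cong (ω ^_) (ℕP.*-comm j q)))))
    off : Π n (offMultiples n u) ≈ 1#
    off = Π-off≈1 n u v (λ j → v (q ℕ.* j)) (λ j n∤j → x-1≉0 (λ ωʲ≈1 → n∤j (ω^≈1⇒∣ j ωʲ≈1))) uv≈v∘q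
            (Π-off-∘-* n q v ∣-refl q⊥n (periodic (λ x → x - 1#) +-congʳ))

  -- Doubling permutes the j with d ∤ j, so the product X satisfies X * X ≈ X.
  Π-off-power≈1 : ∀ d e → d ∣ n → Coprime 2 n → Π n (offMultiples d (λ j → (ω ^ j) ^ e)) ≈ 1#
  Π-off-power≈1 d e d∣n 2⊥n =
    Π-off≈1 d b b (λ j → b (2 ℕ.* j)) (λ j _ → b≉0 j) (λ j _ → bb≈b∘2 j)
      (Π-off-∘-* d 2 b d∣n 2⊥n (periodic (_^ e) (^-congˡ e)))
    where
    b : ℕ → Carrier
    b j = (ω ^ j) ^ e
    b≉0 : ∀ j → ¬ b j ≈ 0#
    b≉0 j bj≈0 = ω^≉0 (j ℕ.* e) (trans (sym (^-assocʳ ω j e)) bj≈0)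
    bb≈b∘2 : ∀ j → b j * b j ≈ b (2 ℕ.* j)
    bb≈b∘2 j = begin
      (ω ^ j) ^ e * (ω ^ j) ^ e      ≈⟨ sym (^-distrib-* (ω ^ j) (ω ^ j) e) ⟩
      (ω ^ j * ω ^ j) ^ e            ≈⟨ ^-congˡ e (sym (^-homo-* ω j j)) ⟩
      (ω ^ (j ℕ.+ j)) ^ e            ≡⟨ ≡.cong (λ t → (ω ^ t) ^ e) (≡.cong (j ℕ.+_) (≡.sym (ℕP.+-identityʳ j))) ⟩
      (ω ^ (2 ℕ.* j)) ^ e            ∎

  M-geom-^ : ∀ q α → Coprime (q ℕ.^ α) n → M R n ω (geom q ^ₚ α) ≈ ι R (+ (q ℕ.^ α))
  M-geom-^ q zero _ = trans (M-oneₚ n ω) (sym (+-identityʳ 1#))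
  M-geom-^ q (suc α) qᵅ⊥n = begin
    M R n ω (geom q ^ₚ suc α)   ≈⟨ M-^ₚ n ω (geom q) (suc α) ⟩
    M R n ω (geom q) ^ suc α    ≈⟨ ^-congˡ (suc α) (M-geom q q⊥n) ⟩
    ι R (+ q) ^ suc α           ≈⟨ sym (ι-^ q (suc α)) ⟩
    ι R (+ (q ℕ.^ suc α))       ∎
    where
    q⊥n : Coprime q n
    q⊥n (d∣q , d∣n) = qᵅ⊥n (∣m⇒∣m*n (q ℕ.^ α) d∣q , d∣n)

  -- F₄ and IsFactorisation fold with anonymous functions, so this is stated for any L and K unfolding like them.
  M-foldr-geom : ∀ {L : ℕ × ℕ → Poly → Poly} {K : ℕ × ℕ → ℕ → ℕ} →
                 (∀ q α r → L (q , α) r ≡ (Φprime q ^ₚ α) *ₚ r) → (∀ q α r → K (q , α) r ≡ (q ℕ.^ α) ℕ.* r) →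
                 ∀ fs → Coprime (foldr K 1 fs) n → M R n ω (foldr L oneₚ fs) ≈ ι R (+ foldr K 1 fs)
  M-foldr-geom L-≡ K-≡ [] _ = trans (M-oneₚ n ω) (sym (+-identityʳ 1#))
  M-foldr-geom {L} {K} L-≡ K-≡ ((q , α) ∷ fs) K⊥n = begin
    M R n ω (L (q , α) (foldr L oneₚ fs))                 ≡⟨ ≡.cong (M R n ω) (L-≡ q α _) ⟩
    M R n ω ((Φprime q ^ₚ α) *ₚ foldr L oneₚ fs)          ≈⟨ M-* n ω _ _ ⟩
    M R n ω (Φprime q ^ₚ α) * M R n ω (foldr L oneₚ fs)   ≈⟨ *-cong (M-geom-^ q α qᵅ⊥n) (M-foldr-geom L-≡ K-≡ fs rest⊥n) ⟩
    ι R (+ (q ℕ.^ α)) * ι R (+ foldr K 1 fs)              ≈⟨ sym (×1-homo-* (q ℕ.^ α) _) ⟩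
    ι R (+ ((q ℕ.^ α) ℕ.* foldr K 1 fs))                  ≡⟨ ≡.cong (λ t → ι R (+ t)) (K-≡ q α _) ⟨
    ι R (+ K (q , α) (foldr K 1 fs))                      ∎
    where
    product⊥n : Coprime ((q ℕ.^ α) ℕ.* foldr K 1 fs) n
    product⊥n = ≡.subst (λ t → Coprime t n) (K-≡ q α _) K⊥n
    qᵅ⊥n : Coprime (q ℕ.^ α) n
    qᵅ⊥n (d∣qᵅ , d∣n) = product⊥n (∣m⇒∣m*n _ d∣qᵅ , d∣n)
    rest⊥n : Coprime (foldr K 1 fs) n
    rest⊥n (d∣r , d∣n) = product⊥n (∣n⇒∣m*n (q ℕ.^ α) d∣r , d∣n)

module OrderThreeP {c ℓ : Level} (R : CommutativeRing c ℓ) (D : CharZeroDomain R) (ω : CommutativeRing.Carrier R)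
              (p : ℕ) (p-prime : Prime p) (3<p : 3 ℕ.< p) (ω-primitive : PrimitiveRoot R (3 ℕ.* p) ω) where
  open import Data.Nat.DivMod
  open import Data.Nat.Divisibility
  open Arithmetic
  open CommutativeRing R
  open RawSemiringDefinitions (Semiring.rawSemiring semiring) using (_^_)
  open import Relation.Binary.Reasoning.Setoid setoid
  open import Algebra.Properties.Semiring.Exp semiring using (^-assocʳ; ^-congˡ; ^-homo-*)
  open import Algebra.Properties.Semiring.Mult semiring using (×1-homo-*)
  open IntegerImage R
  open Powers R
  open Evaluation R
  open Products R

  n : ℕ
  n = 3 ℕ.* p

  0<p : 0 ℕ.< p
  0<p = ℕP.<-trans (ℕ.s≤s ℕ.z≤n) 3<p

  n≥2 : 2 ℕ.≤ n
  n≥2 = ℕP.*-mono-≤ {2} {3} (ℕ.s≤s (ℕ.s≤s ℕ.z≤n)) 0<p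

  open RootsOfUnity R D n n≥2 ω ω-primitive public
  open PrimitiveRoot ω-primitive using (isPrimitive)

  p∣⇒ω^-cubed≈1 : ∀ {j} → p ∣ j → (ω ^ j) ^ 3 ≈ 1#
  p∣⇒ω^-cubed≈1 {j} p∣j = trans (^-assocʳ ω j 3) (∣⇒ω^≈1 (≡.subst (n ∣_) (ℕP.*-comm 3 j) (*-monoʳ-∣ 3 p∣j)))

  ω^-cubed≈1⇒p∣ : ∀ j → (ω ^ j) ^ 3 ≈ 1# → p ∣ j
  ω^-cubed≈1⇒p∣ j ω³ʲ≈1 =
    *-cancelˡ-∣ 3 (≡.subst (n ∣_) (ℕP.*-comm j 3) (ω^≈1⇒∣ (j ℕ.* 3) (trans (sym (^-assocʳ ω j 3)) ω³ʲ≈1)))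

  Π-on-p : ∀ f → Π n (onMultiples p f) ≈ f (3 ℕ.* p) * (f (2 ℕ.* p) * (f (1 ℕ.* p) * 1#))
  Π-on-p f = Π-on p 3 f 0<p

  M-T₃ : M R n ω T₃ ≈ ι R (+ 27)
  M-T₃ = begin
    M R n ω T₃                                              ≈⟨ M≈Π n ω T₃ ⟩
    Π n u                                                   ≈⟨ Π-on*off n p u ⟩
    Π n (onMultiples p u) * Π n (offMultiples p u)          ≈⟨ *-cong (Π-on-p u) off ⟩
    u (3 ℕ.* p) * (u (2 ℕ.* p) * (u (1 ℕ.* p) * 1#)) * 1#   ≈⟨ *-congʳ (*-cong (u-p∣ 3) (*-cong (u-p∣ 2) (*-congʳ (u-p∣ 1)))) ⟩
    ι R (+ 3) * (ι R (+ 3) * (ι R (+ 3) * 1#)) * 1#         ≈⟨ solve 0 (con (+ 3) :* (con (+ 3) :* (con (+ 3) :* con (+ 1))) :* con (+ 1)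
                                                                        := con (+ 27)) refl ⟩
    ι R (+ 27)                                              ∎
    where
    u v : ℕ → Carrier
    u j = eval R T₃ (ω ^ j)
    v j = (ω ^ j) ^ 3 - 1#
    u-p∣ : ∀ i → u (i ℕ.* p) ≈ ι R (+ 3)
    u-p∣ i = eval-T₃-cube-root _ (p∣⇒ω^-cubed≈1 (n∣m*n i))
    p+3⊥3p : Coprime (p ℕ.+ 3) n
    p+3⊥3p = coprime-3p p-prime 3<p
      (λ 3∣p+3 → 3∤p p-prime 3<p (∣m+n∣m⇒∣n (≡.subst (3 ∣_) (ℕP.+-comm p 3) 3∣p+3) ∣-refl))
      (λ p∣p+3 → ℕP.<⇒≱ 3<p (∣⇒≤ (∣m+n∣m⇒∣n p∣p+3 ∣-refl)))
    -- y⁹ = y^(3(p+3)) as y^(3p) = 1.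
    uv≈v∘[p+3] : ∀ j → ¬ p ∣ j → u j * v j ≈ v ((p ℕ.+ 3) ℕ.* j)
    uv≈v∘[p+3] j _ = begin
      eval R T₃ y * (y ^ 3 - 1#)                 ≈⟨ *-congʳ (eval-T₃ y) ⟩
      (1# + y ^ 3 + y ^ 6) * (y ^ 3 - 1#)        ≈⟨ solve 1 (λ Y → (con (+ 1) :+ Y :^ 3 :+ Y :^ 6) :* (Y :^ 3 :- con (+ 1)) := Y :^ 9 :- con (+ 1)) refl y ⟩
      y ^ 9 - 1#                                 ≈⟨ +-congʳ (trans (^-assocʳ ω j 9) (trans (%-≡⇒ω^≈ j9≡) (sym (^-assocʳ ω ((p ℕ.+ 3) ℕ.* j) 3)))) ⟩
      v ((p ℕ.+ 3) ℕ.* j)                        ∎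
      where
      y = ω ^ j
      j9≡ : (j ℕ.* 9) % n ≡ ((p ℕ.+ 3) ℕ.* j ℕ.* 3) % n
      j9≡ = ≡.sym (≡.trans (≡.cong (_% n) (expand p j)) (%-remove-+ʳ (j ℕ.* 9) (n∣m*n j)))
        where
        expand : ∀ p j → (p ℕ.+ 3) ℕ.* j ℕ.* 3 ≡ j ℕ.* 9 ℕ.+ j ℕ.* (3 ℕ.* p)
        expand = solve-∀
    off : Π n (offMultiples p u) ≈ 1#
    off = Π-off≈1 p u v (λ j → v ((p ℕ.+ 3) ℕ.* j))
            (λ j p∤j → x-1≉0 (λ ω³ʲ≈1 → p∤j (ω^-cubed≈1⇒p∣ j ω³ʲ≈1))) uv≈v∘[p+3]
            (Π-off-∘-* p (p ℕ.+ 3) v (n∣m*n 3) p+3⊥3p (periodic (λ x → x ^ 3 - 1#) (λ x≈y → +-congʳ (^-congˡ 3 x≈y))))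

  M-T₃-*ₚ : ∀ G k → M R n ω G ≈ ι R (+ k) → M R n ω (T₃ *ₚ G) ≈ ι R (+ (27 ℕ.* k))
  M-T₃-*ₚ G k MG≈k = trans (M-* n ω T₃ G) (trans (*-cong M-T₃ MG≈k) (sym (×1-homo-* 27 k)))

  M-F₄ : ∀ m → Coprime m n → ∀ fs → IsFactorisation m fs → M R n ω (F₄ fs) ≈ ι R (+ (27 ℕ.* m))
  M-F₄ m m⊥n fs (_ , _ , m≡∏) =
    M-T₃-*ₚ _ m (trans (M-foldr-geom (λ _ _ _ → ≡.refl) (λ _ _ _ → ≡.refl) fs (≡.subst (λ t → Coprime t n) m≡∏ m⊥n))
                       (reflexive (≡.cong (λ t → ι R (+ t)) (≡.sym m≡∏))))

  -- At the primitive cube roots of unity z = ω^p and z² = ω^(2p), the norm of z^N - 1 equals that of z - 1.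
  product-at-cube-roots : ∀ (g : Carrier → Carrier) s N → s * s ≈ ι R (+ 9) → ¬ 3 ∣ N →
                          (∀ x → x ^ 3 ≈ 1# → g x * (x - 1#) ≈ s * (x ^ N - 1#)) →
                          g (ω ^ (2 ℕ.* p)) * g (ω ^ (1 ℕ.* p)) ≈ ι R (+ 9)
  product-at-cube-roots g s N ss≈9 3∤N g-at-cube-root = *-cancelˡ Δ≉0 (begin
    Δ * (g w * g z)                                   ≈⟨ solve 4 (λ A B C E → (A :* B) :* (C :* E) := (E :* A) :* (C :* B)) refl (z - 1#) (w - 1#) (g w) (g z) ⟩
    (g z * (z - 1#)) * (g w * (w - 1#))               ≈⟨ *-cong (g-at-cube-root z z³≈1) (g-at-cube-root w w³≈1) ⟩
    (s * (z ^ N - 1#)) * (s * (w ^ N - 1#))           ≈⟨ solve 3 (λ S A B → (S :* A) :* (S :* B) := (S :* S) :* (A :* B)) refl s (z ^ N - 1#) (w ^ N - 1#) ⟩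
    (s * s) * ((z ^ N - 1#) * (w ^ N - 1#))           ≈⟨ *-cong ss≈9 (*-congˡ (+-congʳ (^-congˡ N w≈zz))) ⟩
    ι R (+ 9) * ((z ^ N - 1#) * ((z * z) ^ N - 1#))   ≈⟨ *-congˡ (cube-root-norm N z³≈1 3∤N) ⟩
    ι R (+ 9) * ((z - 1#) * (z * z - 1#))             ≈⟨ *-comm _ _ ⟩
    (z - 1#) * (z * z - 1#) * ι R (+ 9)               ≈⟨ *-congʳ (*-congˡ (+-congʳ (sym w≈zz))) ⟩
    Δ * ι R (+ 9)                                     ∎)
    where
    z w Δ : Carrier
    z = ω ^ (1 ℕ.* p)
    w = ω ^ (2 ℕ.* p)
    Δ = (z - 1#) * (w - 1#)
    z³≈1 = p∣⇒ω^-cubed≈1 (n∣m*n 1)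
    w³≈1 = p∣⇒ω^-cubed≈1 (n∣m*n 2)
    w≈zz : w ≈ z * z
    w≈zz = trans (reflexive (≡.cong (ω ^_) (ℕP.*-distribʳ-+ p 1 1))) (^-homo-* ω (1 ℕ.* p) (1 ℕ.* p))
    ω^ip≉1 : ∀ i → 0 ℕ.< i → i ℕ.< 3 → ¬ ω ^ (i ℕ.* p) ≈ 1#
    ω^ip≉1 i 0<i i<3 = isPrimitive (i ℕ.* p) (ℕP.*-mono-< 0<i 0<p) (ℕP.*-monoˡ-< p {{ℕ.>-nonZero 0<p}} i<3)
    Δ≉0 : ¬ Δ ≈ 0#
    Δ≉0 = *-≉0 (x-1≉0 (ω^ip≉1 1 (ℕ.s≤s ℕ.z≤n) (ℕ.s≤s (ℕ.s≤s ℕ.z≤n))))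
               (x-1≉0 (ω^ip≉1 2 (ℕ.s≤s ℕ.z≤n) (ℕ.s≤s (ℕ.s≤s (ℕ.s≤s ℕ.z≤n)))))

  private
    3∤2 : ¬ 3 ∣ 2
    3∤2 3∣2 = ℕP.<⇒≱ (ℕ.s≤s (ℕ.s≤s (ℕ.s≤s ℕ.z≤n))) (∣⇒≤ 3∣2)

    p∸3⊥n : Coprime (p ℕ.∸ 3) n
    p∸3⊥n = coprime-3p p-prime 3<p
      (λ 3∣p∸3 → 3∤p p-prime 3<p (∣m∸n∣n⇒∣m 3 (ℕP.<⇒≤ 3<p) 3∣p∸3 ∣-refl))
      (λ p∣p∸3 → ℕP.<⇒≱ (ℕP.∸-monoʳ-< {p} {3} {0} (ℕ.s≤s ℕ.z≤n) (ℕP.<⇒≤ 3<p))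
                        (∣⇒≤ {{ℕ.>-nonZero (ℕP.m<n⇒0<n∸m 3<p)}} p∣p∸3))

    2⊥n : Coprime 2 n
    2⊥n = coprime-3p p-prime 3<p 3∤2 (λ p∣2 → ℕP.<⇒≱ (ℕP.<-trans (ℕ.s≤s (ℕ.s≤s (ℕ.s≤s ℕ.z≤n))) 3<p) (∣⇒≤ p∣2))

    ω^[3p∸9] : ∀ j → (ω ^ j) ^ (3 ℕ.* p ℕ.∸ 9) ≈ (ω ^ ((p ℕ.∸ 3) ℕ.* j)) ^ 3
    ω^[3p∸9] j = begin
      (ω ^ j) ^ (3 ℕ.* p ℕ.∸ 9)         ≈⟨ ^-assocʳ ω j _ ⟩
      ω ^ (j ℕ.* (3 ℕ.* p ℕ.∸ 9))       ≡⟨ ≡.cong (λ t → ω ^ (j ℕ.* t)) (ℕP.*-distribˡ-∸ 3 p 3) ⟨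
      ω ^ (j ℕ.* (3 ℕ.* (p ℕ.∸ 3)))     ≡⟨ ≡.cong (ω ^_) (reorder (p ℕ.∸ 3) j) ⟩
      ω ^ ((p ℕ.∸ 3) ℕ.* j ℕ.* 3)       ≈⟨ ^-assocʳ ω ((p ℕ.∸ 3) ℕ.* j) 3 ⟨
      (ω ^ ((p ℕ.∸ 3) ℕ.* j)) ^ 3       ∎
      where
      reorder : ∀ q j → j ℕ.* (3 ℕ.* q) ≡ q ℕ.* j ℕ.* 3
      reorder = solve-∀

  -- The factor (y - 1)(1 - y³) clears the denominators of F₃(y); the products of the
  -- three factors on the right over p ∤ j are permutations of those of y³ - 1, 1 and 1 - y.
  Π-off-p≈1 : ∀ (f : Carrier → Carrier) e cc → Coprime cc n →
              (∀ j → ¬ p ∣ j → f (ω ^ j) * ((ω ^ j - 1#) * (1# - (ω ^ j) ^ 3))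
                                 ≈ ((ω ^ j) ^ (3 ℕ.* p ℕ.∸ 9) - 1#) * ((ω ^ j) ^ e * (1# - (ω ^ j) ^ cc))) →
              Π n (offMultiples p (λ j → f (ω ^ j))) ≈ 1#
  Π-off-p≈1 f e cc cc⊥n f-identity = Π-off≈1 p (λ j → f (ω ^ j)) Q w Q≉0 fQ≈w (begin
    Π′ w                                                          ≈⟨ trans (Π-off-* n p _ _) (*-congˡ (Π-off-* n p _ _)) ⟩
    Π′ (λ j → v₃ ((p ℕ.∸ 3) ℕ.* j)) * (Π′ b * Π′ (λ j → v₁ (cc ℕ.* j)))
      ≈⟨ *-cong (Π-off-∘-* p (p ℕ.∸ 3) v₃ p∣n p∸3⊥n (periodic (λ x → x ^ 3 - 1#) (λ x≈y → +-congʳ (^-congˡ 3 x≈y))))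
                (*-cong (Π-off-power≈1 p e p∣n 2⊥n) (Π-off-∘-* p cc v₁ p∣n cc⊥n (periodic (λ x → 1# - x) (λ x≈y → +-congˡ (-‿cong x≈y))))) ⟩
    Π′ v₃ * (1# * Π′ v₁)                                          ≈⟨ *-congˡ (*-identityˡ _) ⟩
    Π′ v₃ * Π′ v₁                                                 ≈⟨ sym (Π-off-* n p v₃ v₁) ⟩
    Π′ (λ j → v₃ j * v₁ j)                                        ≈⟨ Π-off-cong n p (λ j _ → v₃v₁≈Q (ω ^ j)) ⟩
    Π′ Q                                                          ∎)
    where
    Π′ : (ℕ → Carrier) → Carrier
    Π′ g = Π n (offMultiples p g)
    p∣n : p ∣ n
    p∣n = n∣m*n 3
    Q v₃ v₁ b w : ℕ → Carrier
    Q j = (ω ^ j - 1#) * (1# - (ω ^ j) ^ 3)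
    v₃ j = (ω ^ j) ^ 3 - 1#
    v₁ j = 1# - ω ^ j
    b j = (ω ^ j) ^ e
    w j = v₃ ((p ℕ.∸ 3) ℕ.* j) * (b j * v₁ (cc ℕ.* j))
    Q≉0 : ∀ j → ¬ p ∣ j → ¬ Q j ≈ 0#
    Q≉0 j p∤j = *-≉0 (x-1≉0 (λ ωʲ≈1 → p∤j (∣-trans p∣n (ω^≈1⇒∣ j ωʲ≈1))))
                     (1-x≉0 (λ ω³ʲ≈1 → p∤j (ω^-cubed≈1⇒p∣ j ω³ʲ≈1)))
    fQ≈w : ∀ j → ¬ p ∣ j → f (ω ^ j) * Q j ≈ w j
    fQ≈w j p∤j = trans (f-identity j p∤j)
      (*-cong (+-congʳ (ω^[3p∸9] j))
              (*-congˡ (+-congˡ (-‿cong (trans (^-assocʳ ω j cc) (reflexive (≡.cong (ω ^_) (ℕP.*-comm j cc))))))))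
    v₃v₁≈Q : ∀ y → (y ^ 3 - 1#) * (1# - y) ≈ (y - 1#) * (1# - y ^ 3)
    v₃v₁≈Q = solve 1 (λ Y → (Y :^ 3 :- con (+ 1)) :* (con (+ 1) :- Y) := (Y :- con (+ 1)) :* (con (+ 1) :- Y :^ 3)) refl

  M≈eval-1*9 : ∀ F s N e cc → s * s ≈ ι R (+ 9) → ¬ 3 ∣ N → Coprime cc n →
               (∀ x → x ^ 3 ≈ 1# → eval R F x * (x - 1#) ≈ s * (x ^ N - 1#)) →
               (∀ j → ¬ p ∣ j → eval R F (ω ^ j) * ((ω ^ j - 1#) * (1# - (ω ^ j) ^ 3))
                                  ≈ ((ω ^ j) ^ (3 ℕ.* p ℕ.∸ 9) - 1#) * ((ω ^ j) ^ e * (1# - (ω ^ j) ^ cc))) →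
               M R n ω F ≈ eval R F 1# * ι R (+ 9)
  M≈eval-1*9 F s N e cc ss≈9 3∤N cc⊥n F-at-cube-root F-identity = begin
    M R n ω F                                                     ≈⟨ M≈Π n ω F ⟩
    Π n u                                                         ≈⟨ Π-on*off n p u ⟩
    Π n (onMultiples p u) * Π n (offMultiples p u)                ≈⟨ *-cong (Π-on-p u) (Π-off-p≈1 (eval R F) e cc cc⊥n F-identity) ⟩
    u (3 ℕ.* p) * (u (2 ℕ.* p) * (u (1 ℕ.* p) * 1#)) * 1#         ≈⟨ trans (*-identityʳ _) (*-congˡ (*-congˡ (*-identityʳ _))) ⟩
    u (3 ℕ.* p) * (u (2 ℕ.* p) * u (1 ℕ.* p))                     ≈⟨ *-cong (eval-cong F (∣⇒ω^≈1 ∣-refl))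
                                                                              (product-at-cube-roots (eval R F) s N ss≈9 3∤N F-at-cube-root) ⟩
    eval R F 1# * ι R (+ 9)                                       ∎
    where
    u : ℕ → Carrier
    u j = eval R F (ω ^ j)

  F₃⁺ : ℕ → Poly
  F₃⁺ N = geom (3 ℕ.* p ℕ.∸ 9) -ₚ X^ (3 ℕ.* p ℕ.∸ 6) *ₚ T₃ *ₚ geom N

  F₃⁻ : ℕ → Poly
  F₃⁻ k = X^ k *ₚ geom (3 ℕ.* p ℕ.∸ 9) +ₚ X^ (3 ℕ.* p ℕ.∸ 6) *ₚ T₃ *ₚ geom k

  a : ℕ
  a = 3 ℕ.* p ℕ.∸ 9

  H : Carrier → Carrier
  H x = eval R (X^ (3 ℕ.* p ℕ.∸ 6) *ₚ T₃) x

  private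
    9≤3p : 9 ℕ.≤ 3 ℕ.* p
    9≤3p = ℕP.*-monoʳ-≤ 3 (ℕP.<⇒≤ 3<p)

  x^a≈1 : ∀ {x} → x ^ 3 ≈ 1# → x ^ a ≈ 1#
  x^a≈1 {x} x³≈1 = begin
    x ^ a                      ≡⟨ ≡.cong (x ^_) (ℕP.*-distribˡ-∸ 3 p 3) ⟨
    x ^ (3 ℕ.* (p ℕ.∸ 3))      ≈⟨ ^-assocʳ x 3 (p ℕ.∸ 3) ⟨
    (x ^ 3) ^ (p ℕ.∸ 3)        ≈⟨ ^-congˡ (p ℕ.∸ 3) x³≈1 ⟩
    1# ^ (p ℕ.∸ 3)             ≈⟨ 1#^ (p ℕ.∸ 3) ⟩
    1#                         ∎

  x^a*x⁹≈1 : ∀ {x} → x ^ n ≈ 1# → x ^ a * (x ^ 3 * (x ^ 3 * x ^ 3)) ≈ 1#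
  x^a*x⁹≈1 {x} xⁿ≈1 = begin
    x ^ a * (x ^ 3 * (x ^ 3 * x ^ 3))   ≈⟨ *-congˡ (*-congˡ (^-homo-* x 3 3)) ⟨
    x ^ a * (x ^ 3 * x ^ 6)             ≈⟨ *-congˡ (^-homo-* x 3 6) ⟨
    x ^ a * x ^ 9                       ≈⟨ ^-homo-* x a 9 ⟨
    x ^ (a ℕ.+ 9)                       ≡⟨ ≡.cong (x ^_) (ℕP.m∸n+n≡m 9≤3p) ⟩
    x ^ n                               ≈⟨ xⁿ≈1 ⟩
    1#                                  ∎

  H≈ : ∀ x → H x ≈ x ^ a * x ^ 3 * (1# + x ^ 3 + x ^ 3 * x ^ 3)
  H≈ x = begin
    H x                                             ≈⟨ eval-* (X^ (3 ℕ.* p ℕ.∸ 6)) T₃ x ⟩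
    eval R (X^ (3 ℕ.* p ℕ.∸ 6)) x * eval R T₃ x     ≈⟨ *-cong (eval-X^ (3 ℕ.* p ℕ.∸ 6) x) (eval-T₃ x) ⟩
    x ^ (3 ℕ.* p ℕ.∸ 6) * (1# + x ^ 3 + x ^ 6)      ≈⟨ *-cong (reflexive (≡.cong (x ^_) 3p∸6≡a+3)) (+-congˡ (^-homo-* x 3 3)) ⟩
    x ^ (a ℕ.+ 3) * (1# + x ^ 3 + x ^ 3 * x ^ 3)    ≈⟨ *-congʳ (^-homo-* x a 3) ⟩
    x ^ a * x ^ 3 * (1# + x ^ 3 + x ^ 3 * x ^ 3)    ∎
    where
    3p∸6≡a+3 : 3 ℕ.* p ℕ.∸ 6 ≡ a ℕ.+ 3
    3p∸6≡a+3 = ≡.trans (≡.cong (ℕ._∸ 6) (≡.sym (ℕP.m∸n+n≡m 9≤3p))) (ℕP.+-∸-assoc a {9} {6} (ℕP.m≤m+n 6 3))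

  H-at-cube-root : ∀ {x} → x ^ 3 ≈ 1# → H x ≈ ι R (+ 3)
  H-at-cube-root {x} x³≈1 = begin
    H x                                              ≈⟨ H≈ x ⟩
    x ^ a * x ^ 3 * (1# + x ^ 3 + x ^ 3 * x ^ 3)     ≈⟨ *-cong (*-cong (x^a≈1 x³≈1) x³≈1) (+-cong (+-congˡ x³≈1) (*-cong x³≈1 x³≈1)) ⟩
    1# * 1# * (1# + 1# + 1# * 1#)                    ≈⟨ solve 0 (con (+ 1) :* con (+ 1) :* (con (+ 1) :+ con (+ 1) :+ con (+ 1) :* con (+ 1)) := con (+ 3)) refl ⟩
    ι R (+ 3)                                        ∎

  H-*-1-x³ : ∀ {x} → x ^ n ≈ 1# → H x * (1# - x ^ 3) ≈ x ^ 3 * (x ^ a - 1#)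
  H-*-1-x³ {x} xⁿ≈1 = begin
    H x * (1# - B)                                  ≈⟨ *-congʳ (H≈ x) ⟩
    A * B * (1# + B + B * B) * (1# - B)             ≈⟨ solve 2 (λ A B → A :* B :* (con (+ 1) :+ B :+ B :* B) :* (con (+ 1) :- B)
                                                                   := B :* (A :- A :* (B :* (B :* B)))) refl A B ⟩
    B * (A - A * (B * (B * B)))                     ≈⟨ *-congˡ (+-congˡ (-‿cong (x^a*x⁹≈1 xⁿ≈1))) ⟩
    B * (A - 1#)                                    ∎
    where
    A = x ^ a
    B = x ^ 3

  F₃⁺-*-x-1 : ∀ N x → eval R (F₃⁺ N) x * (x - 1#) ≈ (x ^ a - 1#) - H x * (x ^ N - 1#)
  F₃⁺-*-x-1 N x = begin
    eval R (F₃⁺ N) x * (x - 1#)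
      ≈⟨ *-congʳ (trans (eval-- (geom a) _ x) (+-congˡ (-‿cong (eval-* (X^ (3 ℕ.* p ℕ.∸ 6) *ₚ T₃) (geom N) x)))) ⟩
    (G a - H x * G N) * (x - 1#)
      ≈⟨ solve 4 (λ Ga Hx GN X → (Ga :- Hx :* GN) :* (X :- con (+ 1)) := Ga :* (X :- con (+ 1)) :- Hx :* (GN :* (X :- con (+ 1))))
               refl (G a) (H x) (G N) x ⟩
    G a * (x - 1#) - H x * (G N * (x - 1#))
      ≈⟨ +-cong (eval-geom-*-x-1 a x) (-‿cong (*-congˡ (eval-geom-*-x-1 N x))) ⟩
    (x ^ a - 1#) - H x * (x ^ N - 1#)               ∎
    where
    G : ℕ → Carrier
    G k = eval R (geom k) x

  F₃⁻-*-x-1 : ∀ k x → eval R (F₃⁻ k) x * (x - 1#) ≈ x ^ k * (x ^ a - 1#) + H x * (x ^ k - 1#)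
  F₃⁻-*-x-1 k x = begin
    eval R (F₃⁻ k) x * (x - 1#)
      ≈⟨ *-congʳ (trans (eval-+ (X^ k *ₚ geom a) _ x)
                        (+-cong (trans (eval-* (X^ k) (geom a) x) (*-congʳ (eval-X^ k x)))
                                (eval-* (X^ (3 ℕ.* p ℕ.∸ 6) *ₚ T₃) (geom k) x))) ⟩
    (x ^ k * G a + H x * G k) * (x - 1#)
      ≈⟨ solve 5 (λ Xk Ga Hx Gk X → (Xk :* Ga :+ Hx :* Gk) :* (X :- con (+ 1))
                                    := Xk :* (Ga :* (X :- con (+ 1))) :+ Hx :* (Gk :* (X :- con (+ 1))))
               refl (x ^ k) (G a) (H x) (G k) x ⟩
    x ^ k * (G a * (x - 1#)) + H x * (G k * (x - 1#))
      ≈⟨ +-cong (*-congˡ (eval-geom-*-x-1 a x)) (*-congˡ (eval-geom-*-x-1 k x)) ⟩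
    x ^ k * (x ^ a - 1#) + H x * (x ^ k - 1#)       ∎
    where
    G : ℕ → Carrier
    G k = eval R (geom k) x

  F₃⁺-at-cube-root : ∀ N x → x ^ 3 ≈ 1# → eval R (F₃⁺ N) x * (x - 1#) ≈ ι R -[1+ 2 ] * (x ^ N - 1#)
  F₃⁺-at-cube-root N x x³≈1 = begin
    eval R (F₃⁺ N) x * (x - 1#)           ≈⟨ F₃⁺-*-x-1 N x ⟩
    (x ^ a - 1#) - H x * (x ^ N - 1#)     ≈⟨ +-cong (+-congʳ (x^a≈1 x³≈1)) (-‿cong (*-congʳ (H-at-cube-root x³≈1))) ⟩
    (1# - 1#) - ι R (+ 3) * (x ^ N - 1#)  ≈⟨ solve 1 (λ C → (con (+ 1) :- con (+ 1)) :- con (+ 3) :* (C :- con (+ 1)) := con -[1+ 2 ] :* (C :- con (+ 1))) refl (x ^ N) ⟩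
    ι R -[1+ 2 ] * (x ^ N - 1#)           ∎

  F₃⁻-at-cube-root : ∀ k x → x ^ 3 ≈ 1# → eval R (F₃⁻ k) x * (x - 1#) ≈ ι R (+ 3) * (x ^ k - 1#)
  F₃⁻-at-cube-root k x x³≈1 = begin
    eval R (F₃⁻ k) x * (x - 1#)                        ≈⟨ F₃⁻-*-x-1 k x ⟩
    x ^ k * (x ^ a - 1#) + H x * (x ^ k - 1#)          ≈⟨ +-cong (*-congˡ (+-congʳ (x^a≈1 x³≈1))) (*-congʳ (H-at-cube-root x³≈1)) ⟩
    x ^ k * (1# - 1#) + ι R (+ 3) * (x ^ k - 1#)       ≈⟨ solve 1 (λ C → C :* (con (+ 1) :- con (+ 1)) :+ con (+ 3) :* (C :- con (+ 1)) := con (+ 3) :* (C :- con (+ 1))) refl (x ^ k) ⟩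
    ι R (+ 3) * (x ^ k - 1#)                           ∎

  F₃⁺-at-root : ∀ N x → x ^ n ≈ 1# →
                eval R (F₃⁺ N) x * ((x - 1#) * (1# - x ^ 3)) ≈ (x ^ a - 1#) * (x ^ 0 * (1# - x ^ (N ℕ.+ 3)))
  F₃⁺-at-root N x xⁿ≈1 = begin
    eval R (F₃⁺ N) x * ((x - 1#) * (1# - B))          ≈⟨ sym (*-assoc _ _ _) ⟩
    eval R (F₃⁺ N) x * (x - 1#) * (1# - B)            ≈⟨ *-congʳ (F₃⁺-*-x-1 N x) ⟩
    ((A - 1#) - H x * (C - 1#)) * (1# - B)            ≈⟨ solve 4 (λ A B C Hx → ((A :- con (+ 1)) :- Hx :* (C :- con (+ 1))) :* (con (+ 1) :- B)
                                                                   := (A :- con (+ 1)) :* (con (+ 1) :- B) :- (Hx :* (con (+ 1) :- B)) :* (C :- con (+ 1)))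
                                                             refl A B C (H x) ⟩
    (A - 1#) * (1# - B) - (H x * (1# - B)) * (C - 1#) ≈⟨ +-congˡ (-‿cong (*-congʳ (H-*-1-x³ xⁿ≈1))) ⟩
    (A - 1#) * (1# - B) - (B * (A - 1#)) * (C - 1#)   ≈⟨ solve 3 (λ A B C → (A :- con (+ 1)) :* (con (+ 1) :- B) :- (B :* (A :- con (+ 1))) :* (C :- con (+ 1))
                                                                 := (A :- con (+ 1)) :* (con (+ 1) :* (con (+ 1) :- C :* B)))
                                                             refl A B C ⟩
    (A - 1#) * (1# * (1# - C * B))                    ≈⟨ *-congˡ (*-congˡ (+-congˡ (-‿cong (sym (^-homo-* x N 3))))) ⟩
    (A - 1#) * (1# * (1# - x ^ (N ℕ.+ 3)))            ∎
    where
    A = x ^ a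
    B = x ^ 3
    C = x ^ N

  F₃⁻-at-root : ∀ k cc → k ℕ.+ cc ≡ 3 ℕ.+ n ℕ.* k → ∀ x → x ^ n ≈ 1# →
                eval R (F₃⁻ k) x * ((x - 1#) * (1# - x ^ 3)) ≈ (x ^ a - 1#) * (x ^ k * (1# - x ^ cc))
  F₃⁻-at-root k cc k+cc≡3+nk x xⁿ≈1 = begin
    eval R (F₃⁻ k) x * ((x - 1#) * (1# - B))                 ≈⟨ sym (*-assoc _ _ _) ⟩
    eval R (F₃⁻ k) x * (x - 1#) * (1# - B)                   ≈⟨ *-congʳ (F₃⁻-*-x-1 k x) ⟩
    (Dk * (A - 1#) + H x * (Dk - 1#)) * (1# - B)             ≈⟨ solve 4 (λ A B Dk Hx → (Dk :* (A :- con (+ 1)) :+ Hx :* (Dk :- con (+ 1))) :* (con (+ 1) :- B)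
                                                                         := Dk :* (A :- con (+ 1)) :* (con (+ 1) :- B) :+ (Hx :* (con (+ 1) :- B)) :* (Dk :- con (+ 1)))
                                                                    refl A B Dk (H x) ⟩
    Dk * (A - 1#) * (1# - B) + (H x * (1# - B)) * (Dk - 1#)  ≈⟨ +-congˡ (*-congʳ (H-*-1-x³ xⁿ≈1)) ⟩
    Dk * (A - 1#) * (1# - B) + (B * (A - 1#)) * (Dk - 1#)    ≈⟨ solve 3 (λ A B Dk → Dk :* (A :- con (+ 1)) :* (con (+ 1) :- B) :+ (B :* (A :- con (+ 1))) :* (Dk :- con (+ 1))
                                                                         := (A :- con (+ 1)) :* (Dk :- B))
                                                                    refl A B Dk ⟩
    (A - 1#) * (Dk - B)                                      ≈⟨ *-congˡ (+-congˡ (-‿cong (sym DkG≈B))) ⟩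
    (A - 1#) * (Dk - Dk * G)                                 ≈⟨ *-congˡ (solve 2 (λ D G → D :- D :* G := D :* (con (+ 1) :- G)) refl Dk G) ⟩
    (A - 1#) * (Dk * (1# - G))                               ∎
    where
    A = x ^ a
    B = x ^ 3
    Dk = x ^ k
    G = x ^ cc
    DkG≈B : Dk * G ≈ B
    DkG≈B = begin
      x ^ k * x ^ cc            ≈⟨ ^-homo-* x k cc ⟨
      x ^ (k ℕ.+ cc)            ≡⟨ ≡.cong (x ^_) k+cc≡3+nk ⟩
      x ^ (3 ℕ.+ n ℕ.* k)       ≈⟨ ^-homo-* x 3 (n ℕ.* k) ⟩
      x ^ 3 * x ^ (n ℕ.* k)     ≈⟨ *-congˡ (trans (sym (^-assocʳ x n k)) (trans (^-congˡ k xⁿ≈1) (1#^ k))) ⟩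
      x ^ 3 * 1#                ≈⟨ *-identityʳ _ ⟩
      x ^ 3                     ∎

  private
    ι-∸ : ∀ a b → ι R (a ℤ.- b) ≈ ι R a - ι R b
    ι-∸ a b = trans (ι-+ a (ℤ.- b)) (+-congˡ (ι-neg b))

    H1≈3 : H 1# ≈ ι R (+ 3)
    H1≈3 = H-at-cube-root (1#^ 3)

  F₃⁺-at-1 : ∀ N → eval R (F₃⁺ N) 1# ≈ ι R (+ a ℤ.- + 3 ℤ.* + N)
  F₃⁺-at-1 N = begin
    eval R (F₃⁺ N) 1#                                      ≈⟨ trans (eval-- (geom a) _ 1#) (+-congˡ (-‿cong (eval-* (X^ (3 ℕ.* p ℕ.∸ 6) *ₚ T₃) (geom N) 1#))) ⟩
    eval R (geom a) 1# - H 1# * eval R (geom N) 1#         ≈⟨ +-cong (eval-geom-1 a) (-‿cong (*-cong H1≈3 (eval-geom-1 N))) ⟩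
    ι R (+ a) - ι R (+ 3) * ι R (+ N)                      ≈⟨ +-congˡ (-‿cong (ι-* (+ 3) (+ N))) ⟨
    ι R (+ a) - ι R (+ 3 ℤ.* + N)                          ≈⟨ ι-∸ (+ a) (+ 3 ℤ.* + N) ⟨
    ι R (+ a ℤ.- + 3 ℤ.* + N)                              ∎

  F₃⁻-at-1 : ∀ k → eval R (F₃⁻ k) 1# ≈ ι R (+ a ℤ.+ + 3 ℤ.* + k)
  F₃⁻-at-1 k = begin
    eval R (F₃⁻ k) 1#                                      ≈⟨ trans (eval-+ (X^ k *ₚ geom a) _ 1#) (+-cong (eval-* (X^ k) (geom a) 1#) (eval-* (X^ (3 ℕ.* p ℕ.∸ 6) *ₚ T₃) (geom k) 1#)) ⟩
    eval R (X^ k) 1# * eval R (geom a) 1# + H 1# * eval R (geom k) 1#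
                                                           ≈⟨ +-cong (*-cong (trans (eval-X^ k 1#) (1#^ k)) (eval-geom-1 a)) (*-cong H1≈3 (eval-geom-1 k)) ⟩
    1# * ι R (+ a) + ι R (+ 3) * ι R (+ k)                 ≈⟨ +-cong (*-identityˡ _) (sym (ι-* (+ 3) (+ k))) ⟩
    ι R (+ a) + ι R (+ 3 ℤ.* + k)                          ≈⟨ ι-+ (+ a) (+ 3 ℤ.* + k) ⟨
    ι R (+ a ℤ.+ + 3 ℤ.* + k)                              ∎

  private
    ι[9m]*9≈ι[81m] : ∀ m → ι R (+ 9 ℤ.* m) * ι R (+ 9) ≈ ι R (+ 81 ℤ.* m)
    ι[9m]*9≈ι[81m] m = begin
      ι R (+ 9 ℤ.* m) * ι R (+ 9)       ≈⟨ *-congʳ (ι-* (+ 9) m) ⟩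
      ι R (+ 9) * ι R m * ι R (+ 9)     ≈⟨ solve 1 (λ M → con (+ 9) :* M :* con (+ 9) := con (+ 81) :* M) refl (ι R m) ⟩
      ι R (+ 81) * ι R m                ≈⟨ ι-* (+ 81) m ⟨
      ι R (+ 81 ℤ.* m)                  ∎

  M-F₃ : ∀ m → ¬ + p ℤ∣.∣ m → M R n ω (F₃ p m) ≈ ι R (+ 81 ℤ.* m)
  M-F₃ m p∤m with + (p ℕ.∸ 3) ℤ.- + 3 ℤ.* m in δ≡
  ... | + N = begin
    M R n ω (F₃⁺ N)                  ≈⟨ M≈eval-1*9 (F₃⁺ N) (ι R -[1+ 2 ]) N 0 (N ℕ.+ 3) [-3]²≈9 3∤N N+3⊥n
                                                   (F₃⁺-at-cube-root N) (λ j _ → F₃⁺-at-root N (ω ^ j) ([ω^j]^n≈1 j)) ⟩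
    eval R (F₃⁺ N) 1# * ι R (+ 9)    ≈⟨ *-congʳ (trans (F₃⁺-at-1 N) (reflexive (≡.cong (ι R) value))) ⟩
    ι R (+ 9 ℤ.* m) * ι R (+ 9)      ≈⟨ ι[9m]*9≈ι[81m] m ⟩
    ι R (+ 81 ℤ.* m)                 ∎
    where
    open F₃-Exponents p-prime 3<p m p∤m using (module NonNegative)
    open NonNegative N δ≡
    [-3]²≈9 : ι R -[1+ 2 ] * ι R -[1+ 2 ] ≈ ι R (+ 9)
    [-3]²≈9 = solve 0 (con -[1+ 2 ] :* con -[1+ 2 ] := con (+ 9)) refl
  ... | -[1+ j ] = begin
    M R n ω (F₃⁻ k)                  ≈⟨ M≈eval-1*9 (F₃⁻ k) (ι R (+ 3)) k k cc 3²≈9 3∤k cc⊥n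
                                                   (F₃⁻-at-cube-root k) (λ j _ → F₃⁻-at-root k cc k+cc≡3+nk (ω ^ j) ([ω^j]^n≈1 j)) ⟩
    eval R (F₃⁻ k) 1# * ι R (+ 9)    ≈⟨ *-congʳ (trans (F₃⁻-at-1 k) (reflexive (≡.cong (ι R) value))) ⟩
    ι R (+ 9 ℤ.* m) * ι R (+ 9)      ≈⟨ ι[9m]*9≈ι[81m] m ⟩
    ι R (+ 81 ℤ.* m)                 ∎
    where
    k = suc j
    open F₃-Exponents p-prime 3<p m p∤m using (module Negative)
    open Negative k δ≡
    3²≈9 : ι R (+ 3) * ι R (+ 3) ≈ ι R (+ 9)
    3²≈9 = solve 0 (con (+ 3) :* con (+ 3) := con (+ 9)) refl


open import Data.Nat using (ℕ; _<_; _*_)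
open import Data.Nat.Primality using (Prime)
open import Data.Nat.Coprimality using (Coprime)
open import Data.Integer using (ℤ; +_)
open import Data.Integer.Divisibility using (_∣_)
import Data.Integer as ℤ
open import Data.List using (List)
open import Data.Product using (_×_)
open import Relation.Nullary using (¬_; yes; no)
open import Algebra.Bundles using (CommutativeRing)

lemma4 : ∀ {c ℓ} (R : CommutativeRing c ℓ) → CharZeroDomain R →
         (ω : CommutativeRing.Carrier R) →
         (p : ℕ) → Prime p → 3 < p → PrimitiveRoot R (3 * p) ω →
         ((m : ℤ) → ¬ ((+ p) ∣ m) →
            CommutativeRing._≈_ R (M R (3 * p) ω (F₃ p m)) (ι R ((+ 81) ℤ.* m)))
         × ((m : ℕ) → 0 < m → Coprime m (3 * p) → (fs : List (ℕ × ℕ)) →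
            IsFactorisation m fs →
            CommutativeRing._≈_ R (M R (3 * p) ω (F₄ fs)) (ι R (+ (27 * m))))
lemma4 R D ω p p-prime 3<p ω-primitive = M-F₃ , λ m _ → M-F₄ m
  where open OrderThreeP R D ω p p-prime 3<p ω-primitive
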